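{- There is a partition $(B_0,\ldots,B_{15})$ of $H(4,4)$ into sixteen $(4,16,3)_4$ codes that cannot be lengthened to a partition of $H(5,4)$ into sixteen $1$-perfect $(5,64,3)_4$ codes; that is, there are no sets $B_i^1,B_i^2,B_i^3$ of words of length $4$ such that the codes $B_i0\cup B_i^1 1\cup B_i^2 2\cup B_i^3 3$, $i=0,\ldots,15$, form a partition of $H(5,4)$ into $1$-perfect codes.
   Context: $H(n,q)$ is the Hamming graph on the $n$-words over $\{0,1,\ldots,q-1\}$, adjacent words differing in exactly one position. An $(n,M,d)_q$-code is a set of $M$ vertices with minimum Hamming distance $d$. For a code $C$ and a symbol $a$, $Ca:=\{\mathbf{c}a:\ \mathbf{c}\in C\}$ (concatenation). A $1$-perfect code is a set of vertices such that every vertex is at distance $0$ or $1$ from exactly one element of it. -}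

module Defs where

open import Data.Nat using (ℕ; zero; suc; _≤_)
open import Data.Fin using (Fin; zero; suc)
open import Data.Fin.Properties using (_≟_)
open import Data.Vec using (Vec; []; _∷_; init; last)
open import Data.List using (List; []; _∷_; length; filterᵇ; concatMap; map; allFin)
open import Data.Bool using (Bool; true; false; _∧_; _∨_)
open import Data.Product using (Σ; _×_; _,_; ∃)
open import Relation.Nullary using (¬_; does)
open import Relation.Binary.PropositionalEquality using (_≡_; _≢_)

Word : ℕ → Set
Word n = Vec (Fin 4) n

dist : ∀ {n} → Word n → Word n → ℕ
dist []       []       = zero
dist (x ∷ xs) (y ∷ ys) with does (x ≟ y)
... | true  = dist xs ys
... | false = suc (dist xs ys)

VSet : ℕ → Set
VSet n = Word n → Bool

_∈ₛ_ : ∀ {n} → Word n → VSet n → Set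
w ∈ₛ C = C w ≡ true

allWords : (n : ℕ) → List (Word n)
allWords zero    = [] ∷ []
allWords (suc n) = concatMap (λ a → map (a ∷_) (allWords n)) (allFin 4)

card : ∀ {n} → VSet n → ℕ
card {n} C = length (filterᵇ C (allWords n))

IsCode : (n M d : ℕ) → VSet n → Set
IsCode n M d C =
  card C ≡ M
  × (∀ x y → x ∈ₛ C → y ∈ₛ C → x ≢ y → d ≤ dist x y)
  × Σ (Word n) (λ x → Σ (Word n) (λ y → x ∈ₛ C × y ∈ₛ C × x ≢ y × dist x y ≡ d))

IsPerfect1 : ∀ {n} → VSet n → Set
IsPerfect1 {n} C =
  ∀ v → Σ (Word n) (λ c → c ∈ₛ C × dist v c ≤ 1
          × (∀ c′ → c′ ∈ₛ C → dist v c′ ≤ 1 → c′ ≡ c))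

-- (B_0,...,B_{k-1}) is a partition of H(n,4): every vertex lies in exactly one B_i
-- (empty parts are allowed here; for the codes in question, sizes are fixed anyway)
IsPartition : ∀ {n k} → (Fin k → VSet n) → Set
IsPartition {n} {k} B =
  ∀ w → Σ (Fin k) (λ i → w ∈ₛ B i × (∀ j → w ∈ₛ B j → j ≡ i))

cat : ∀ {n} → VSet n → Fin 4 → VSet (suc n)
cat C a w = does (last w ≟ a) ∧ C (init w)

-- B0 ∪ B¹1 ∪ B²2 ∪ B³3, where E k = B^(k+1)
lengthen : VSet 4 → (Fin 3 → VSet 4) → VSet 5
lengthen B E w =
  cat B zero w ∨ (cat (E zero) (suc zero) w ∨ (cat (E (suc zero)) (suc (suc zero)) w
    ∨ cat (E (suc (suc zero))) (suc (suc (suc zero))) w))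

-- Suppose the parts B_t lengthen to a partition of H(5,4) into 1-perfect codes C_t. If w is at
-- distance at least 2 from B_t, the codeword of C_t covering w0 is not in B_t 0, so it is w a for
-- a nonzero symbol a_t(w). Two such pairs (t,w), (t',w') need distinct symbols when t = t' and
-- d(w,w') = 2 (C_t has minimum distance 3) and when t ≠ t' and w = w' (the C_t are disjoint).
-- Hence (t,w) ↦ a_t(w) properly 3-colours this conflict graph, and for the partition below a
-- finite part of that graph is shown not to be 3-colourable by an explicit case-split tree.
{-# OPTIONS --safe #-}
module Submission where

open import Defs
open import Data.Fin using (Fin)
open import Data.Product using (Σ; _×_)
open import Relation.Nullary using (¬_)

open import Data.Bool using (Bool; true; false; T; _∧_; if_then_else_)
open import Data.Bool.Properties using (T-∧; T-≡; ∨-identityʳ) renaming (_≟_ to _≟ᵇ_)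
open import Data.Empty using (⊥; ⊥-elim)
open import Data.Fin using (zero; suc)
open import Data.Fin.Properties using (_≟_; any?; all?)
open import Data.List using (List; []; _∷_; map; head; drop)
import Data.List.Membership.DecPropositional as DecMembership
open import Data.List.Membership.Propositional using (_∈_; find)
open import Data.List.Membership.Propositional.Properties using (∈-allFin; ∈-map⁺; ∈-concatMap⁺)
open import Data.List.Relation.Unary.All as All using (All; []; _∷_)
open import Data.List.Relation.Unary.Any as Any using (Any; here)
open import Data.Maybe using (Maybe; just; nothing; fromMaybe)
open import Data.Maybe.Properties using (just-injective)
import Data.Nat as ℕ
open import Data.Nat using (ℕ; _≤_; _+_; z≤n; s≤s⁻¹; _≤?_)
open import Data.Nat.Properties
  using (≤-refl; ≤-reflexive; ≤⇒≯; +-identityʳ; +-cancelʳ-≤; n≤0⇒n≡0; 1+n≢0)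
  renaming (_≟_ to _≟ℕ_)
open import Data.Product using (∃; _,_; proj₁; proj₂)
open import Data.Sum using (_⊎_; inj₁; inj₂)
open import Data.Unit using (tt)
open import Data.Vec using (Vec; []; _∷_; _∷ʳ_; initLast)
import Data.Vec as Vec
open import Data.Vec.Properties using (init-∷ʳ; last-∷ʳ; ≡-dec)
open import Function using (_∘_; Equivalence)
open import Relation.Binary.Definitions using (DecidableEquality)
open import Relation.Binary.PropositionalEquality using (_≡_; _≢_; refl; sym; trans; cong; cong₂; subst; module ≡-Reasoning)
open import Relation.Nullary using (Dec; yes; no; does)
open import Relation.Nullary.Decidable using (isYes; toWitness; fromWitness; dec-true; dec-false; ¬?; _×-dec_; _⊎-dec_; _→-dec_)

private
  variable
    k n M d : ℕ

_≟ʷ_ : DecidableEquality (Word n)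
_≟ʷ_ = ≡-dec _≟_

dist-∷-≡ : ∀ a (x y : Word n) → dist (a ∷ x) (a ∷ y) ≡ dist x y
dist-∷-≡ a x y rewrite dec-true (a ≟ a) refl = refl

dist-∷-≢ : ∀ {a b} (x y : Word n) → a ≢ b → dist (a ∷ x) (b ∷ y) ≡ 1 + dist x y
dist-∷-≢ {a = a} {b} x y a≢b rewrite dec-false (a ≟ b) a≢b = refl

dist-refl : (x : Word n) → dist x x ≡ 0
dist-refl []      = refl
dist-refl (a ∷ x) = trans (dist-∷-≡ a x x) (dist-refl x)

dist-sym : (x y : Word n) → dist x y ≡ dist y x
dist-sym []      []      = refl
dist-sym (a ∷ x) (b ∷ y) with a ≟ b
... | yes refl = trans (dist-sym x y) (sym (dist-∷-≡ a y x))
... | no a≢b   = trans (cong (1 +_) (dist-sym x y)) (sym (dist-∷-≢ y x (a≢b ∘ sym)))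

dist≡0⇒≡ : {x y : Word n} → dist x y ≡ 0 → x ≡ y
dist≡0⇒≡ {x = []}    {[]}    _   = refl
dist≡0⇒≡ {x = a ∷ x} {b ∷ y} x≈y with a ≟ b
... | yes refl = cong (a ∷_) (dist≡0⇒≡ x≈y)
... | no _     = ⊥-elim (1+n≢0 x≈y)

dist-∷ʳ : (x y : Word n) (a b : Fin 4) → dist (x ∷ʳ a) (y ∷ʳ b) ≡ dist x y + dist (a ∷ []) (b ∷ [])
dist-∷ʳ []      []      a b = refl
dist-∷ʳ (c ∷ x) (e ∷ y) a b with does (c ≟ e)
... | true  = dist-∷ʳ x y a b
... | false = cong (1 +_) (dist-∷ʳ x y a b)

common-neighbour : (x y : Word n) → dist x y ≤ 2 → ∃ λ v → dist v x ≤ 1 × dist v y ≤ 1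
common-neighbour []      []      _   = [] , z≤n , z≤n
common-neighbour (a ∷ x) (b ∷ y) x~y with a ≟ b
... | yes refl =
  let v , v~x , v~y = common-neighbour x y x~y
  in  a ∷ v , subst (_≤ 1) (sym (dist-∷-≡ a v x)) v~x , subst (_≤ 1) (sym (dist-∷-≡ a v y)) v~y
... | no a≢b   = a ∷ y , y~x , y~by
  where
  y~x : dist (a ∷ y) (a ∷ x) ≤ 1
  y~x = subst (_≤ 1) (sym (trans (dist-∷-≡ a y x) (dist-sym y x))) (s≤s⁻¹ x~y)
  y~by : dist (a ∷ y) (b ∷ y) ≤ 1
  y~by = subst (_≤ 1) (sym (trans (dist-∷-≢ y y a≢b) (cong (1 +_) (dist-refl y)))) ≤-refl

perfect-dist≤2⇒≡ : {C : VSet n} → IsPerfect1 C → ∀ {x y} → x ∈ₛ C → y ∈ₛ C → dist x y ≤ 2 → x ≡ y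
perfect-dist≤2⇒≡ perfect {x} {y} x∈C y∈C x~y =
  let v , v~x , v~y    = common-neighbour x y x~y
      _ , _ , _ , once = perfect v
  in  trans (once x x∈C v~x) (sym (once y y∈C v~y))

lengthen-∷ʳ-zero : ∀ B E (x : Word 4) → lengthen B E (x ∷ʳ zero) ≡ B x
lengthen-∷ʳ-zero B E x rewrite init-∷ʳ zero x | last-∷ʳ zero x = ∨-identityʳ (B x)

Far : VSet n → Word n → Set
Far C w = ∀ c → c ∈ₛ C → 2 ≤ dist w c

far⇒covered-by-nonzero : ∀ {B E w} → IsPerfect1 (lengthen B E) → Far B w →
                         ∃ λ (j : Fin 3) → (w ∷ʳ suc j) ∈ₛ lengthen B E
far⇒covered-by-nonzero {B} {E} {w} perfect far =
  let c , c∈ , c~w0 , _ = perfect (w ∷ʳ zero)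
      x , b , c≡xb      = initLast c
  in  nonzero-last x b (subst (_∈ₛ lengthen B E) c≡xb c∈)
                       (subst (λ y → dist (w ∷ʳ zero) y ≤ 1) c≡xb c~w0)
  where
  nonzero-last : ∀ x b → (x ∷ʳ b) ∈ₛ lengthen B E → dist (w ∷ʳ zero) (x ∷ʳ b) ≤ 1 →
                 ∃ λ (j : Fin 3) → (w ∷ʳ suc j) ∈ₛ lengthen B E
  nonzero-last x zero xb∈ w0~xb = ⊥-elim (≤⇒≯ w~x (far x (trans (sym (lengthen-∷ʳ-zero B E x)) xb∈)))
    where
    w~x : dist w x ≤ 1
    w~x = subst (_≤ 1) (trans (dist-∷ʳ w x zero zero) (+-identityʳ (dist w x))) w0~xb
  nonzero-last x (suc j) xb∈ w0~xb = j , subst (λ y → (y ∷ʳ suc j) ∈ₛ lengthen B E) (sym w≡x) xb∈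
    where
    w≡x : w ≡ x
    w≡x = dist≡0⇒≡ (n≤0⇒n≡0 (+-cancelʳ-≤ 1 (dist w x) 0
                                 (subst (_≤ 1) (dist-∷ʳ w x zero (suc j)) w0~xb)))

Conflict : Fin k × Word n → Fin k × Word n → Set
Conflict (t , w) (t′ , w′) = (t ≡ t′ × dist w w′ ≡ 2) ⊎ (t ≢ t′ × w ≡ w′)

conflict? : (p q : Fin k × Word n) → Dec (Conflict p q)
conflict? (t , w) (t′ , w′) = ((t ≟ t′) ×-dec (dist w w′ ≟ℕ 2)) ⊎-dec (¬? (t ≟ t′) ×-dec (w ≟ʷ w′))

conflict⇒¬same-symbol : {Λ : Fin k → VSet (1 + n)} → IsPartition Λ → (∀ i → IsPerfect1 (Λ i)) →
                        ∀ {t w t′ w′} a → Conflict (t , w) (t′ , w′) →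
                        (w ∷ʳ a) ∈ₛ Λ t → (w′ ∷ʳ a) ∈ₛ Λ t′ → ⊥
conflict⇒¬same-symbol partition perfect {t} {w} {w′ = w′} a (inj₁ (refl , w~w′)) wa∈ w′a∈ =
  1+n≢0 (begin
    2                          ≡⟨ sym wa~w′a ⟩
    dist (w ∷ʳ a) (w′ ∷ʳ a)    ≡⟨ cong (λ z → dist z (w′ ∷ʳ a)) wa≡w′a ⟩
    dist (w′ ∷ʳ a) (w′ ∷ʳ a)   ≡⟨ dist-refl (w′ ∷ʳ a) ⟩
    0                          ∎)
  where
  open ≡-Reasoning
  wa~w′a : dist (w ∷ʳ a) (w′ ∷ʳ a) ≡ 2
  wa~w′a = trans (dist-∷ʳ w w′ a a) (cong₂ _+_ w~w′ (dist-refl (a ∷ [])))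
  wa≡w′a : w ∷ʳ a ≡ w′ ∷ʳ a
  wa≡w′a = perfect-dist≤2⇒≡ (perfect t) wa∈ w′a∈ (≤-reflexive wa~w′a)
conflict⇒¬same-symbol partition perfect {t} {w} {t′} a (inj₂ (t≢t′ , refl)) wa∈ w′a∈ =
  let _ , _ , only = partition (w ∷ʳ a) in t≢t′ (trans (only t wa∈) (sym (only t′ w′a∈)))

T-∧⁻ : ∀ x {y} → T (x ∧ y) → T x × T y
T-∧⁻ x = Equivalence.to (T-∧ {x})

data Refutation (V : Set) : Set where
  clash  : V → V → Refutation V
  branch : V → Refutation V → Refutation V → Refutation V → Refutation V

module ThreeColouring {V : Set} (_≟ᵛ_ : DecidableEquality V)
                      {Adj : V → V → Set} (adjacent? : ∀ u v → Dec (Adj u v)) where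

  Assignment : Set
  Assignment = List (V × Fin 3)

  colourOf : Assignment → V → Maybe (Fin 3)
  colourOf []            u = nothing
  colourOf ((v , c) ∷ σ) u = if does (u ≟ᵛ v) then just c else colourOf σ u

  sameColourᵇ : Maybe (Fin 3) → Maybe (Fin 3) → Bool
  sameColourᵇ (just c) (just c′) = isYes (c ≟ c′)
  sameColourᵇ _        _         = false

  refutes : Assignment → Refutation V → Bool
  refutes σ (clash u v)          = isYes (adjacent? u v) ∧ sameColourᵇ (colourOf σ u) (colourOf σ v)
  refutes σ (branch u t₀ t₁ t₂) =
    refutes ((u , zero) ∷ σ) t₀ ∧ (refutes ((u , suc zero) ∷ σ) t₁ ∧ refutes ((u , suc (suc zero)) ∷ σ) t₂)

  branch-valid : ∀ σ u t₀ t₁ t₂ → T (refutes σ (branch u t₀ t₁ t₂)) →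
                 T (refutes ((u , zero) ∷ σ) t₀) × T (refutes ((u , suc zero) ∷ σ) t₁)
                 × T (refutes ((u , suc (suc zero)) ∷ σ) t₂)
  branch-valid σ u t₀ t₁ _ valid =
    let valid₀ , valid₁₂ = T-∧⁻ (refutes ((u , zero) ∷ σ) t₀) valid
    in  valid₀ , T-∧⁻ (refutes ((u , suc zero) ∷ σ) t₁) valid₁₂

  Proper : (V → Fin 3) → Set
  Proper col = ∀ u v → Adj u v → col u ≢ col v

  module _ (col : V → Fin 3) (proper : Proper col) where

    Agrees : Assignment → Set
    Agrees = All (λ (v , c) → col v ≡ c)

    colourOf-agrees : ∀ {σ u c} → Agrees σ → colourOf σ u ≡ just c → col u ≡ c
    colourOf-agrees {(v , _) ∷ σ} {u} (col-v ∷ agrees) σu with u ≟ᵛ v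
    ... | yes refl = trans col-v (just-injective σu)
    ... | no _     = colourOf-agrees agrees σu

    refutation-sound : ∀ σ t → Agrees σ → ¬ T (refutes σ t)
    refutation-sound σ (clash u v) agrees valid with colourOf σ u in σu | colourOf σ v in σv
    ... | just c | just c′ =
      let adj , c≡c′ = T-∧⁻ (isYes (adjacent? u v)) valid
      in  proper u v (toWitness adj) (trans (colourOf-agrees agrees σu)
                                     (trans (toWitness c≡c′) (sym (colourOf-agrees agrees σv))))
    ... | just _  | nothing = proj₂ (T-∧⁻ (isYes (adjacent? u v)) valid)
    ... | nothing | _       = proj₂ (T-∧⁻ (isYes (adjacent? u v)) valid)
    refutation-sound σ (branch u t₀ t₁ t₂) agrees valid with branch-valid σ u t₀ t₁ t₂ valid | col u in col-u
    ... | valid₀ , _      , _      | zero           = refutation-sound _ t₀ (col-u ∷ agrees) valid₀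
    ... | _      , valid₁ , _      | suc zero       = refutation-sound _ t₁ (col-u ∷ agrees) valid₁
    ... | _      , _      , valid₂ | suc (suc zero) = refutation-sound _ t₂ (col-u ∷ agrees) valid₂

allWords-complete : (w : Word n) → w ∈ allWords n
allWords-complete []      = here refl
allWords-complete {n = ℕ.suc n} (a ∷ w) =
  ∈-concatMap⁺ (λ b → map (b ∷_) (allWords n))
               (Any.map (λ { refl → ∈-map⁺ (a ∷_) (allWords-complete w) }) (∈-allFin a))

∀-fromAllWords : {P : Word n → Set} → All P (allWords n) → ∀ w → P w
∀-fromAllWords ps w = All.lookup ps (allWords-complete w)

listSet : List (Word n) → VSet n
listSet L w = isYes (DecMembership._∈?_ _≟ʷ_ w L)

∈ₛ-listSet⁻ : {L : List (Word n)} {w : Word n} → w ∈ₛ listSet L → w ∈ L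
∈ₛ-listSet⁻ = toWitness ∘ Equivalence.from T-≡

∈ₛ-listSet⁺ : {L : List (Word n)} {w : Word n} → w ∈ L → w ∈ₛ listSet L
∈ₛ-listSet⁺ = Equivalence.to T-≡ ∘ fromWitness

all-far⇒Far : {L : List (Word n)} {w : Word n} → All (λ c → 2 ≤ dist w c) L → Far (listSet L) w
all-far⇒Far far c c∈ = All.lookup far (∈ₛ-listSet⁻ c∈)

uniquePart? : (B : Fin k → VSet n) (w : Word n) →
              Dec (Σ (Fin k) λ i → w ∈ₛ B i × (∀ j → w ∈ₛ B j → j ≡ i))
uniquePart? B w = any? λ i → (B i w ≟ᵇ true) ×-dec all? λ j → (B j w ≟ᵇ true) →-dec (j ≟ i)

DistanceAtLeast : ℕ → List (Word n) → Set
DistanceAtLeast d L = All (λ x → All (λ y → x ≢ y → d ≤ dist x y) L) L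

DistanceAttained : ℕ → List (Word n) → Set
DistanceAttained d L = Any (λ x → Any (λ y → x ≢ y × dist x y ≡ d) L) L

distanceAtLeast? : ∀ d (L : List (Word n)) → Dec (DistanceAtLeast d L)
distanceAtLeast? d L = All.all? (λ x → All.all? (λ y → ¬? (x ≟ʷ y) →-dec (d ≤? dist x y)) L) L

distanceAttained? : ∀ d (L : List (Word n)) → Dec (DistanceAttained d L)
distanceAttained? d L = Any.any? (λ x → Any.any? (λ y → ¬? (x ≟ʷ y) ×-dec (dist x y ≟ℕ d)) L) L

listSet-isCode : {L : List (Word n)} → card (listSet L) ≡ M → DistanceAtLeast d L → DistanceAttained d L →
                 IsCode n M d (listSet L)
listSet-isCode card≡M atLeast attained =
  card≡M ,
  (λ x y x∈ y∈ → All.lookup (All.lookup atLeast (∈ₛ-listSet⁻ x∈)) (∈ₛ-listSet⁻ y∈)) ,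
  (let x , x∈ , attained-x  = find attained
       y , y∈ , x≢y , x~y = find attained-x
   in  x , y , ∈ₛ-listSet⁺ x∈ , ∈ₛ-listSet⁺ y∈ , x≢y , x~y)

module _ (codes : Fin k → List (Word 4)) where

  Remote : Fin k × Word 4 → Set
  Remote (t , w) = All (λ c → 2 ≤ dist w c) (codes t)

  remote? : ∀ p → Dec (Remote p)
  remote? (t , w) = All.all? (λ c → 2 ≤? dist w c) (codes t)

  Adjacent : Fin k × Word 4 → Fin k × Word 4 → Set
  Adjacent p q = Remote p × Remote q × Conflict p q

  adjacent? : ∀ p q → Dec (Adjacent p q)
  adjacent? p q = remote? p ×-dec remote? q ×-dec conflict? p q

  module _ (vertex : ℕ → Fin k × Word 4) where
    open ThreeColouring _≟ℕ_ (λ u v → adjacent? (vertex u) (vertex v))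

    no-lengthening : (cert : Refutation ℕ) → T (refutes [] cert) →
                     ¬ Σ (Fin k → Fin 3 → VSet 4) (λ E →
                         IsPartition (λ i → lengthen (listSet (codes i)) (E i))
                         × (∀ i → IsPerfect1 (lengthen (listSet (codes i)) (E i))))
    no-lengthening cert valid (E , partition , perfect) = refutation-sound colour proper [] cert [] valid
      where
      cover : ∀ t w → Remote (t , w) → ∃ λ (j : Fin 3) → (w ∷ʳ suc j) ∈ₛ lengthen (listSet (codes t)) (E t)
      cover t w remote = far⇒covered-by-nonzero {listSet (codes t)} {E t} {w} (perfect t)
                                                (all-far⇒Far {L = codes t} {w} remote)

      colourAt : ∀ p → Dec (Remote p) → Fin 3
      colourAt (t , w) (yes remote) = proj₁ (cover t w remote)
      colourAt _       (no _)       = zero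

      colourAt-covers : ∀ t w r? → Remote (t , w) →
                        (w ∷ʳ suc (colourAt (t , w) r?)) ∈ₛ lengthen (listSet (codes t)) (E t)
      colourAt-covers t w (yes remote) _ = proj₂ (cover t w remote)
      colourAt-covers t w (no ¬remote) remote = ⊥-elim (¬remote remote)

      colour : ℕ → Fin 3
      colour u = colourAt (vertex u) (remote? (vertex u))

      adjacent⇒distinct : ∀ p q → Adjacent p q → colourAt p (remote? p) ≢ colourAt q (remote? q)
      adjacent⇒distinct (t , w) (t′ , w′) (remote , remote′ , conflict) same =
        conflict⇒¬same-symbol partition perfect {t} {w} {t′} {w′} (suc (colourAt (t , w) (remote? (t , w))))
          conflict (colourAt-covers t w (remote? (t , w)) remote)
          (subst (λ j → (w′ ∷ʳ suc j) ∈ₛ lengthen (listSet (codes t′)) (E t′)) (sym same)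
                 (colourAt-covers t′ w′ (remote? (t′ , w′)) remote′))

      proper : Proper colour
      proper u v = adjacent⇒distinct (vertex u) (vertex v)

-- Numerals are overloaded (as Fin literals) only here, so the certificate's many ℕ literals stay primitive.
module Tables where
  open import Agda.Builtin.FromNat using (Number; fromNat)
  import Data.Fin.Literals as FinLiterals
  import Data.Nat.Literals as ℕLiterals

  instance
    ℕ-number : Number ℕ
    ℕ-number = ℕLiterals.number

    Fin-number : Number (Fin n)
    Fin-number = FinLiterals.number _

  codeTable : Vec (List (Word 4)) 16
  codeTable =
      ( (0 ∷ 0 ∷ 0 ∷ 0 ∷ []) ∷ (0 ∷ 1 ∷ 1 ∷ 3 ∷ []) ∷ (0 ∷ 2 ∷ 2 ∷ 2 ∷ []) ∷ (0 ∷ 3 ∷ 3 ∷ 1 ∷ [])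
        ∷ (1 ∷ 0 ∷ 3 ∷ 3 ∷ []) ∷ (1 ∷ 1 ∷ 2 ∷ 0 ∷ []) ∷ (1 ∷ 2 ∷ 1 ∷ 1 ∷ []) ∷ (1 ∷ 3 ∷ 0 ∷ 2 ∷ [])
        ∷ (2 ∷ 0 ∷ 2 ∷ 1 ∷ []) ∷ (2 ∷ 1 ∷ 3 ∷ 2 ∷ []) ∷ (2 ∷ 2 ∷ 0 ∷ 3 ∷ []) ∷ (2 ∷ 3 ∷ 1 ∷ 0 ∷ [])
        ∷ (3 ∷ 0 ∷ 1 ∷ 2 ∷ []) ∷ (3 ∷ 1 ∷ 0 ∷ 1 ∷ []) ∷ (3 ∷ 2 ∷ 3 ∷ 0 ∷ []) ∷ (3 ∷ 3 ∷ 2 ∷ 3 ∷ []) ∷ [])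
    ∷ ( (0 ∷ 0 ∷ 0 ∷ 1 ∷ []) ∷ (0 ∷ 1 ∷ 1 ∷ 0 ∷ []) ∷ (0 ∷ 2 ∷ 3 ∷ 3 ∷ []) ∷ (0 ∷ 3 ∷ 2 ∷ 2 ∷ [])
        ∷ (1 ∷ 0 ∷ 3 ∷ 0 ∷ []) ∷ (1 ∷ 1 ∷ 2 ∷ 1 ∷ []) ∷ (1 ∷ 2 ∷ 0 ∷ 2 ∷ []) ∷ (1 ∷ 3 ∷ 1 ∷ 3 ∷ [])
        ∷ (2 ∷ 0 ∷ 1 ∷ 2 ∷ []) ∷ (2 ∷ 1 ∷ 0 ∷ 3 ∷ []) ∷ (2 ∷ 2 ∷ 2 ∷ 0 ∷ []) ∷ (2 ∷ 3 ∷ 3 ∷ 1 ∷ [])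
        ∷ (3 ∷ 0 ∷ 2 ∷ 3 ∷ []) ∷ (3 ∷ 1 ∷ 3 ∷ 2 ∷ []) ∷ (3 ∷ 2 ∷ 1 ∷ 1 ∷ []) ∷ (3 ∷ 3 ∷ 0 ∷ 0 ∷ []) ∷ [])
    ∷ ( (0 ∷ 0 ∷ 0 ∷ 2 ∷ []) ∷ (0 ∷ 1 ∷ 1 ∷ 1 ∷ []) ∷ (0 ∷ 2 ∷ 2 ∷ 0 ∷ []) ∷ (0 ∷ 3 ∷ 3 ∷ 3 ∷ [])
        ∷ (1 ∷ 0 ∷ 2 ∷ 3 ∷ []) ∷ (1 ∷ 1 ∷ 3 ∷ 0 ∷ []) ∷ (1 ∷ 2 ∷ 0 ∷ 1 ∷ []) ∷ (1 ∷ 3 ∷ 1 ∷ 2 ∷ [])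
        ∷ (2 ∷ 0 ∷ 3 ∷ 1 ∷ []) ∷ (2 ∷ 1 ∷ 2 ∷ 2 ∷ []) ∷ (2 ∷ 2 ∷ 1 ∷ 3 ∷ []) ∷ (2 ∷ 3 ∷ 0 ∷ 0 ∷ [])
        ∷ (3 ∷ 0 ∷ 1 ∷ 0 ∷ []) ∷ (3 ∷ 1 ∷ 0 ∷ 3 ∷ []) ∷ (3 ∷ 2 ∷ 3 ∷ 2 ∷ []) ∷ (3 ∷ 3 ∷ 2 ∷ 1 ∷ []) ∷ [])
    ∷ ( (0 ∷ 0 ∷ 0 ∷ 3 ∷ []) ∷ (0 ∷ 1 ∷ 1 ∷ 2 ∷ []) ∷ (0 ∷ 2 ∷ 2 ∷ 1 ∷ []) ∷ (0 ∷ 3 ∷ 3 ∷ 0 ∷ [])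
        ∷ (1 ∷ 0 ∷ 1 ∷ 1 ∷ []) ∷ (1 ∷ 1 ∷ 0 ∷ 0 ∷ []) ∷ (1 ∷ 2 ∷ 3 ∷ 3 ∷ []) ∷ (1 ∷ 3 ∷ 2 ∷ 2 ∷ [])
        ∷ (2 ∷ 0 ∷ 3 ∷ 2 ∷ []) ∷ (2 ∷ 1 ∷ 2 ∷ 3 ∷ []) ∷ (2 ∷ 2 ∷ 1 ∷ 0 ∷ []) ∷ (2 ∷ 3 ∷ 0 ∷ 1 ∷ [])
        ∷ (3 ∷ 0 ∷ 2 ∷ 0 ∷ []) ∷ (3 ∷ 1 ∷ 3 ∷ 1 ∷ []) ∷ (3 ∷ 2 ∷ 0 ∷ 2 ∷ []) ∷ (3 ∷ 3 ∷ 1 ∷ 3 ∷ []) ∷ [])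
    ∷ ( (0 ∷ 0 ∷ 1 ∷ 0 ∷ []) ∷ (0 ∷ 1 ∷ 0 ∷ 3 ∷ []) ∷ (0 ∷ 2 ∷ 3 ∷ 2 ∷ []) ∷ (0 ∷ 3 ∷ 2 ∷ 1 ∷ [])
        ∷ (1 ∷ 0 ∷ 3 ∷ 1 ∷ []) ∷ (1 ∷ 1 ∷ 2 ∷ 2 ∷ []) ∷ (1 ∷ 2 ∷ 1 ∷ 3 ∷ []) ∷ (1 ∷ 3 ∷ 0 ∷ 0 ∷ [])
        ∷ (2 ∷ 0 ∷ 2 ∷ 3 ∷ []) ∷ (2 ∷ 1 ∷ 3 ∷ 0 ∷ []) ∷ (2 ∷ 2 ∷ 0 ∷ 1 ∷ []) ∷ (2 ∷ 3 ∷ 1 ∷ 2 ∷ [])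
        ∷ (3 ∷ 0 ∷ 0 ∷ 2 ∷ []) ∷ (3 ∷ 1 ∷ 1 ∷ 1 ∷ []) ∷ (3 ∷ 2 ∷ 2 ∷ 0 ∷ []) ∷ (3 ∷ 3 ∷ 3 ∷ 3 ∷ []) ∷ [])
    ∷ ( (0 ∷ 0 ∷ 1 ∷ 1 ∷ []) ∷ (0 ∷ 1 ∷ 0 ∷ 0 ∷ []) ∷ (0 ∷ 2 ∷ 2 ∷ 3 ∷ []) ∷ (0 ∷ 3 ∷ 3 ∷ 2 ∷ [])
        ∷ (1 ∷ 0 ∷ 2 ∷ 0 ∷ []) ∷ (1 ∷ 1 ∷ 3 ∷ 1 ∷ []) ∷ (1 ∷ 2 ∷ 1 ∷ 2 ∷ []) ∷ (1 ∷ 3 ∷ 0 ∷ 3 ∷ [])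
        ∷ (2 ∷ 0 ∷ 0 ∷ 2 ∷ []) ∷ (2 ∷ 1 ∷ 1 ∷ 3 ∷ []) ∷ (2 ∷ 2 ∷ 3 ∷ 0 ∷ []) ∷ (2 ∷ 3 ∷ 2 ∷ 1 ∷ [])
        ∷ (3 ∷ 0 ∷ 3 ∷ 3 ∷ []) ∷ (3 ∷ 1 ∷ 2 ∷ 2 ∷ []) ∷ (3 ∷ 2 ∷ 0 ∷ 1 ∷ []) ∷ (3 ∷ 3 ∷ 1 ∷ 0 ∷ []) ∷ [])
    ∷ ( (0 ∷ 0 ∷ 1 ∷ 2 ∷ []) ∷ (0 ∷ 1 ∷ 0 ∷ 1 ∷ []) ∷ (0 ∷ 2 ∷ 3 ∷ 0 ∷ []) ∷ (0 ∷ 3 ∷ 2 ∷ 3 ∷ [])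
        ∷ (1 ∷ 0 ∷ 2 ∷ 1 ∷ []) ∷ (1 ∷ 1 ∷ 3 ∷ 2 ∷ []) ∷ (1 ∷ 2 ∷ 0 ∷ 3 ∷ []) ∷ (1 ∷ 3 ∷ 1 ∷ 0 ∷ [])
        ∷ (2 ∷ 0 ∷ 3 ∷ 3 ∷ []) ∷ (2 ∷ 1 ∷ 2 ∷ 0 ∷ []) ∷ (2 ∷ 2 ∷ 1 ∷ 1 ∷ []) ∷ (2 ∷ 3 ∷ 0 ∷ 2 ∷ [])
        ∷ (3 ∷ 0 ∷ 0 ∷ 0 ∷ []) ∷ (3 ∷ 1 ∷ 1 ∷ 3 ∷ []) ∷ (3 ∷ 2 ∷ 2 ∷ 2 ∷ []) ∷ (3 ∷ 3 ∷ 3 ∷ 1 ∷ []) ∷ [])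
    ∷ ( (0 ∷ 0 ∷ 1 ∷ 3 ∷ []) ∷ (0 ∷ 1 ∷ 3 ∷ 1 ∷ []) ∷ (0 ∷ 2 ∷ 0 ∷ 2 ∷ []) ∷ (0 ∷ 3 ∷ 2 ∷ 0 ∷ [])
        ∷ (1 ∷ 0 ∷ 0 ∷ 1 ∷ []) ∷ (1 ∷ 1 ∷ 2 ∷ 3 ∷ []) ∷ (1 ∷ 2 ∷ 1 ∷ 0 ∷ []) ∷ (1 ∷ 3 ∷ 3 ∷ 2 ∷ [])
        ∷ (2 ∷ 0 ∷ 3 ∷ 0 ∷ []) ∷ (2 ∷ 1 ∷ 1 ∷ 2 ∷ []) ∷ (2 ∷ 2 ∷ 2 ∷ 1 ∷ []) ∷ (2 ∷ 3 ∷ 0 ∷ 3 ∷ [])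
        ∷ (3 ∷ 0 ∷ 2 ∷ 2 ∷ []) ∷ (3 ∷ 1 ∷ 0 ∷ 0 ∷ []) ∷ (3 ∷ 2 ∷ 3 ∷ 3 ∷ []) ∷ (3 ∷ 3 ∷ 1 ∷ 1 ∷ []) ∷ [])
    ∷ ( (0 ∷ 0 ∷ 2 ∷ 0 ∷ []) ∷ (0 ∷ 1 ∷ 0 ∷ 2 ∷ []) ∷ (0 ∷ 2 ∷ 3 ∷ 1 ∷ []) ∷ (0 ∷ 3 ∷ 1 ∷ 3 ∷ [])
        ∷ (1 ∷ 0 ∷ 3 ∷ 2 ∷ []) ∷ (1 ∷ 1 ∷ 1 ∷ 0 ∷ []) ∷ (1 ∷ 2 ∷ 2 ∷ 3 ∷ []) ∷ (1 ∷ 3 ∷ 0 ∷ 1 ∷ [])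
        ∷ (2 ∷ 0 ∷ 0 ∷ 3 ∷ []) ∷ (2 ∷ 1 ∷ 2 ∷ 1 ∷ []) ∷ (2 ∷ 2 ∷ 1 ∷ 2 ∷ []) ∷ (2 ∷ 3 ∷ 3 ∷ 0 ∷ [])
        ∷ (3 ∷ 0 ∷ 1 ∷ 1 ∷ []) ∷ (3 ∷ 1 ∷ 3 ∷ 3 ∷ []) ∷ (3 ∷ 2 ∷ 0 ∷ 0 ∷ []) ∷ (3 ∷ 3 ∷ 2 ∷ 2 ∷ []) ∷ [])
    ∷ ( (0 ∷ 0 ∷ 2 ∷ 1 ∷ []) ∷ (0 ∷ 1 ∷ 3 ∷ 3 ∷ []) ∷ (0 ∷ 2 ∷ 0 ∷ 0 ∷ []) ∷ (0 ∷ 3 ∷ 1 ∷ 2 ∷ [])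
        ∷ (1 ∷ 0 ∷ 0 ∷ 3 ∷ []) ∷ (1 ∷ 1 ∷ 1 ∷ 1 ∷ []) ∷ (1 ∷ 2 ∷ 2 ∷ 2 ∷ []) ∷ (1 ∷ 3 ∷ 3 ∷ 0 ∷ [])
        ∷ (2 ∷ 0 ∷ 1 ∷ 0 ∷ []) ∷ (2 ∷ 1 ∷ 0 ∷ 2 ∷ []) ∷ (2 ∷ 2 ∷ 3 ∷ 1 ∷ []) ∷ (2 ∷ 3 ∷ 2 ∷ 3 ∷ [])
        ∷ (3 ∷ 0 ∷ 3 ∷ 2 ∷ []) ∷ (3 ∷ 1 ∷ 2 ∷ 0 ∷ []) ∷ (3 ∷ 2 ∷ 1 ∷ 3 ∷ []) ∷ (3 ∷ 3 ∷ 0 ∷ 1 ∷ []) ∷ [])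
    ∷ ( (0 ∷ 0 ∷ 2 ∷ 2 ∷ []) ∷ (0 ∷ 1 ∷ 3 ∷ 0 ∷ []) ∷ (0 ∷ 2 ∷ 0 ∷ 3 ∷ []) ∷ (0 ∷ 3 ∷ 1 ∷ 1 ∷ [])
        ∷ (1 ∷ 0 ∷ 0 ∷ 0 ∷ []) ∷ (1 ∷ 1 ∷ 1 ∷ 2 ∷ []) ∷ (1 ∷ 2 ∷ 2 ∷ 1 ∷ []) ∷ (1 ∷ 3 ∷ 3 ∷ 3 ∷ [])
        ∷ (2 ∷ 0 ∷ 1 ∷ 3 ∷ []) ∷ (2 ∷ 1 ∷ 0 ∷ 1 ∷ []) ∷ (2 ∷ 2 ∷ 3 ∷ 2 ∷ []) ∷ (2 ∷ 3 ∷ 2 ∷ 0 ∷ [])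
        ∷ (3 ∷ 0 ∷ 3 ∷ 1 ∷ []) ∷ (3 ∷ 1 ∷ 2 ∷ 3 ∷ []) ∷ (3 ∷ 2 ∷ 1 ∷ 0 ∷ []) ∷ (3 ∷ 3 ∷ 0 ∷ 2 ∷ []) ∷ [])
    ∷ ( (0 ∷ 0 ∷ 2 ∷ 3 ∷ []) ∷ (0 ∷ 1 ∷ 3 ∷ 2 ∷ []) ∷ (0 ∷ 2 ∷ 0 ∷ 1 ∷ []) ∷ (0 ∷ 3 ∷ 1 ∷ 0 ∷ [])
        ∷ (1 ∷ 0 ∷ 0 ∷ 2 ∷ []) ∷ (1 ∷ 1 ∷ 1 ∷ 3 ∷ []) ∷ (1 ∷ 2 ∷ 2 ∷ 0 ∷ []) ∷ (1 ∷ 3 ∷ 3 ∷ 1 ∷ [])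
        ∷ (2 ∷ 0 ∷ 1 ∷ 1 ∷ []) ∷ (2 ∷ 1 ∷ 0 ∷ 0 ∷ []) ∷ (2 ∷ 2 ∷ 3 ∷ 3 ∷ []) ∷ (2 ∷ 3 ∷ 2 ∷ 2 ∷ [])
        ∷ (3 ∷ 0 ∷ 3 ∷ 0 ∷ []) ∷ (3 ∷ 1 ∷ 2 ∷ 1 ∷ []) ∷ (3 ∷ 2 ∷ 1 ∷ 2 ∷ []) ∷ (3 ∷ 3 ∷ 0 ∷ 3 ∷ []) ∷ [])
    ∷ ( (0 ∷ 0 ∷ 3 ∷ 0 ∷ []) ∷ (0 ∷ 1 ∷ 2 ∷ 1 ∷ []) ∷ (0 ∷ 2 ∷ 1 ∷ 2 ∷ []) ∷ (0 ∷ 3 ∷ 0 ∷ 3 ∷ [])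
        ∷ (1 ∷ 0 ∷ 2 ∷ 2 ∷ []) ∷ (1 ∷ 1 ∷ 3 ∷ 3 ∷ []) ∷ (1 ∷ 2 ∷ 0 ∷ 0 ∷ []) ∷ (1 ∷ 3 ∷ 1 ∷ 1 ∷ [])
        ∷ (2 ∷ 0 ∷ 0 ∷ 1 ∷ []) ∷ (2 ∷ 1 ∷ 1 ∷ 0 ∷ []) ∷ (2 ∷ 2 ∷ 2 ∷ 3 ∷ []) ∷ (2 ∷ 3 ∷ 3 ∷ 2 ∷ [])
        ∷ (3 ∷ 0 ∷ 1 ∷ 3 ∷ []) ∷ (3 ∷ 1 ∷ 0 ∷ 2 ∷ []) ∷ (3 ∷ 2 ∷ 3 ∷ 1 ∷ []) ∷ (3 ∷ 3 ∷ 2 ∷ 0 ∷ []) ∷ [])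
    ∷ ( (0 ∷ 0 ∷ 3 ∷ 1 ∷ []) ∷ (0 ∷ 1 ∷ 2 ∷ 2 ∷ []) ∷ (0 ∷ 2 ∷ 1 ∷ 3 ∷ []) ∷ (0 ∷ 3 ∷ 0 ∷ 0 ∷ [])
        ∷ (1 ∷ 0 ∷ 1 ∷ 2 ∷ []) ∷ (1 ∷ 1 ∷ 0 ∷ 1 ∷ []) ∷ (1 ∷ 2 ∷ 3 ∷ 0 ∷ []) ∷ (1 ∷ 3 ∷ 2 ∷ 3 ∷ [])
        ∷ (2 ∷ 0 ∷ 2 ∷ 0 ∷ []) ∷ (2 ∷ 1 ∷ 3 ∷ 3 ∷ []) ∷ (2 ∷ 2 ∷ 0 ∷ 2 ∷ []) ∷ (2 ∷ 3 ∷ 1 ∷ 1 ∷ [])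
        ∷ (3 ∷ 0 ∷ 0 ∷ 3 ∷ []) ∷ (3 ∷ 1 ∷ 1 ∷ 0 ∷ []) ∷ (3 ∷ 2 ∷ 2 ∷ 1 ∷ []) ∷ (3 ∷ 3 ∷ 3 ∷ 2 ∷ []) ∷ [])
    ∷ ( (0 ∷ 0 ∷ 3 ∷ 2 ∷ []) ∷ (0 ∷ 1 ∷ 2 ∷ 3 ∷ []) ∷ (0 ∷ 2 ∷ 1 ∷ 0 ∷ []) ∷ (0 ∷ 3 ∷ 0 ∷ 1 ∷ [])
        ∷ (1 ∷ 0 ∷ 1 ∷ 3 ∷ []) ∷ (1 ∷ 1 ∷ 0 ∷ 2 ∷ []) ∷ (1 ∷ 2 ∷ 3 ∷ 1 ∷ []) ∷ (1 ∷ 3 ∷ 2 ∷ 0 ∷ [])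
        ∷ (2 ∷ 0 ∷ 0 ∷ 0 ∷ []) ∷ (2 ∷ 1 ∷ 1 ∷ 1 ∷ []) ∷ (2 ∷ 2 ∷ 2 ∷ 2 ∷ []) ∷ (2 ∷ 3 ∷ 3 ∷ 3 ∷ [])
        ∷ (3 ∷ 0 ∷ 2 ∷ 1 ∷ []) ∷ (3 ∷ 1 ∷ 3 ∷ 0 ∷ []) ∷ (3 ∷ 2 ∷ 0 ∷ 3 ∷ []) ∷ (3 ∷ 3 ∷ 1 ∷ 2 ∷ []) ∷ [])
    ∷ ( (0 ∷ 0 ∷ 3 ∷ 3 ∷ []) ∷ (0 ∷ 1 ∷ 2 ∷ 0 ∷ []) ∷ (0 ∷ 2 ∷ 1 ∷ 1 ∷ []) ∷ (0 ∷ 3 ∷ 0 ∷ 2 ∷ [])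
        ∷ (1 ∷ 0 ∷ 1 ∷ 0 ∷ []) ∷ (1 ∷ 1 ∷ 0 ∷ 3 ∷ []) ∷ (1 ∷ 2 ∷ 3 ∷ 2 ∷ []) ∷ (1 ∷ 3 ∷ 2 ∷ 1 ∷ [])
        ∷ (2 ∷ 0 ∷ 2 ∷ 2 ∷ []) ∷ (2 ∷ 1 ∷ 3 ∷ 1 ∷ []) ∷ (2 ∷ 2 ∷ 0 ∷ 0 ∷ []) ∷ (2 ∷ 3 ∷ 1 ∷ 3 ∷ [])
        ∷ (3 ∷ 0 ∷ 0 ∷ 1 ∷ []) ∷ (3 ∷ 1 ∷ 1 ∷ 2 ∷ []) ∷ (3 ∷ 2 ∷ 2 ∷ 3 ∷ []) ∷ (3 ∷ 3 ∷ 3 ∷ 0 ∷ []) ∷ [])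
    ∷ []

  vertexTable : List (Fin 16 × Word 4)
  vertexTable =
      (0 , (0 ∷ 0 ∷ 1 ∷ 1 ∷ [])) ∷ (0 , (0 ∷ 0 ∷ 2 ∷ 3 ∷ [])) ∷ (0 , (0 ∷ 0 ∷ 3 ∷ 2 ∷ [])) ∷ (0 , (0 ∷ 1 ∷ 0 ∷ 2 ∷ []))
    ∷ (0 , (0 ∷ 1 ∷ 2 ∷ 1 ∷ [])) ∷ (0 , (0 ∷ 1 ∷ 3 ∷ 0 ∷ [])) ∷ (0 , (0 ∷ 2 ∷ 0 ∷ 1 ∷ [])) ∷ (0 , (0 ∷ 2 ∷ 1 ∷ 0 ∷ []))
    ∷ (0 , (0 ∷ 2 ∷ 3 ∷ 3 ∷ [])) ∷ (0 , (0 ∷ 3 ∷ 0 ∷ 3 ∷ [])) ∷ (0 , (0 ∷ 3 ∷ 1 ∷ 2 ∷ [])) ∷ (0 , (0 ∷ 3 ∷ 2 ∷ 0 ∷ []))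
    ∷ (0 , (1 ∷ 0 ∷ 0 ∷ 1 ∷ [])) ∷ (0 , (1 ∷ 0 ∷ 1 ∷ 0 ∷ [])) ∷ (0 , (1 ∷ 0 ∷ 2 ∷ 2 ∷ [])) ∷ (0 , (1 ∷ 1 ∷ 0 ∷ 3 ∷ []))
    ∷ (0 , (1 ∷ 1 ∷ 1 ∷ 2 ∷ [])) ∷ (0 , (1 ∷ 1 ∷ 3 ∷ 1 ∷ [])) ∷ (0 , (1 ∷ 2 ∷ 0 ∷ 0 ∷ [])) ∷ (0 , (1 ∷ 2 ∷ 2 ∷ 3 ∷ []))
    ∷ (0 , (1 ∷ 2 ∷ 3 ∷ 2 ∷ [])) ∷ (0 , (1 ∷ 3 ∷ 1 ∷ 3 ∷ [])) ∷ (0 , (1 ∷ 3 ∷ 2 ∷ 1 ∷ [])) ∷ (0 , (1 ∷ 3 ∷ 3 ∷ 0 ∷ []))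
    ∷ (0 , (2 ∷ 0 ∷ 0 ∷ 2 ∷ [])) ∷ (0 , (2 ∷ 0 ∷ 1 ∷ 3 ∷ [])) ∷ (0 , (2 ∷ 0 ∷ 3 ∷ 0 ∷ [])) ∷ (0 , (2 ∷ 1 ∷ 0 ∷ 0 ∷ []))
    ∷ (0 , (2 ∷ 1 ∷ 1 ∷ 1 ∷ [])) ∷ (0 , (2 ∷ 1 ∷ 2 ∷ 3 ∷ [])) ∷ (0 , (2 ∷ 2 ∷ 1 ∷ 2 ∷ [])) ∷ (0 , (2 ∷ 2 ∷ 2 ∷ 0 ∷ []))
    ∷ (0 , (2 ∷ 2 ∷ 3 ∷ 1 ∷ [])) ∷ (0 , (2 ∷ 3 ∷ 0 ∷ 1 ∷ [])) ∷ (0 , (2 ∷ 3 ∷ 2 ∷ 2 ∷ [])) ∷ (0 , (2 ∷ 3 ∷ 3 ∷ 3 ∷ []))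
    ∷ (0 , (3 ∷ 0 ∷ 0 ∷ 3 ∷ [])) ∷ (0 , (3 ∷ 0 ∷ 2 ∷ 0 ∷ [])) ∷ (0 , (3 ∷ 0 ∷ 3 ∷ 1 ∷ [])) ∷ (0 , (3 ∷ 1 ∷ 1 ∷ 0 ∷ []))
    ∷ (0 , (3 ∷ 1 ∷ 2 ∷ 2 ∷ [])) ∷ (0 , (3 ∷ 1 ∷ 3 ∷ 3 ∷ [])) ∷ (0 , (3 ∷ 2 ∷ 0 ∷ 2 ∷ [])) ∷ (0 , (3 ∷ 2 ∷ 1 ∷ 3 ∷ []))
    ∷ (0 , (3 ∷ 2 ∷ 2 ∷ 1 ∷ [])) ∷ (0 , (3 ∷ 3 ∷ 0 ∷ 0 ∷ [])) ∷ (0 , (3 ∷ 3 ∷ 1 ∷ 1 ∷ [])) ∷ (0 , (3 ∷ 3 ∷ 3 ∷ 2 ∷ []))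
    ∷ (1 , (0 ∷ 0 ∷ 1 ∷ 3 ∷ [])) ∷ (1 , (0 ∷ 0 ∷ 2 ∷ 0 ∷ [])) ∷ (1 , (0 ∷ 0 ∷ 3 ∷ 2 ∷ [])) ∷ (1 , (0 ∷ 1 ∷ 0 ∷ 2 ∷ []))
    ∷ (1 , (0 ∷ 1 ∷ 2 ∷ 3 ∷ [])) ∷ (1 , (0 ∷ 1 ∷ 3 ∷ 1 ∷ [])) ∷ (1 , (0 ∷ 2 ∷ 0 ∷ 0 ∷ [])) ∷ (1 , (0 ∷ 2 ∷ 1 ∷ 2 ∷ []))
    ∷ (1 , (0 ∷ 2 ∷ 2 ∷ 1 ∷ [])) ∷ (1 , (0 ∷ 3 ∷ 0 ∷ 3 ∷ [])) ∷ (1 , (0 ∷ 3 ∷ 1 ∷ 1 ∷ [])) ∷ (1 , (0 ∷ 3 ∷ 3 ∷ 0 ∷ []))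
    ∷ (1 , (1 ∷ 0 ∷ 0 ∷ 3 ∷ [])) ∷ (1 , (1 ∷ 0 ∷ 1 ∷ 1 ∷ [])) ∷ (1 , (1 ∷ 0 ∷ 2 ∷ 2 ∷ [])) ∷ (1 , (1 ∷ 1 ∷ 0 ∷ 0 ∷ []))
    ∷ (1 , (1 ∷ 1 ∷ 1 ∷ 2 ∷ [])) ∷ (1 , (1 ∷ 1 ∷ 3 ∷ 3 ∷ [])) ∷ (1 , (1 ∷ 2 ∷ 1 ∷ 0 ∷ [])) ∷ (1 , (1 ∷ 2 ∷ 2 ∷ 3 ∷ []))
    ∷ (1 , (1 ∷ 2 ∷ 3 ∷ 1 ∷ [])) ∷ (1 , (1 ∷ 3 ∷ 0 ∷ 1 ∷ [])) ∷ (1 , (1 ∷ 3 ∷ 2 ∷ 0 ∷ [])) ∷ (1 , (1 ∷ 3 ∷ 3 ∷ 2 ∷ []))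
    ∷ (1 , (2 ∷ 0 ∷ 0 ∷ 0 ∷ [])) ∷ (1 , (2 ∷ 0 ∷ 2 ∷ 1 ∷ [])) ∷ (1 , (2 ∷ 0 ∷ 3 ∷ 3 ∷ [])) ∷ (1 , (2 ∷ 1 ∷ 1 ∷ 1 ∷ []))
    ∷ (1 , (2 ∷ 1 ∷ 2 ∷ 2 ∷ [])) ∷ (1 , (2 ∷ 1 ∷ 3 ∷ 0 ∷ [])) ∷ (1 , (2 ∷ 2 ∷ 0 ∷ 1 ∷ [])) ∷ (1 , (2 ∷ 2 ∷ 1 ∷ 3 ∷ []))
    ∷ (1 , (2 ∷ 2 ∷ 3 ∷ 2 ∷ [])) ∷ (1 , (2 ∷ 3 ∷ 0 ∷ 2 ∷ [])) ∷ (1 , (2 ∷ 3 ∷ 1 ∷ 0 ∷ [])) ∷ (1 , (2 ∷ 3 ∷ 2 ∷ 3 ∷ []))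
    ∷ (1 , (3 ∷ 0 ∷ 0 ∷ 2 ∷ [])) ∷ (1 , (3 ∷ 0 ∷ 1 ∷ 0 ∷ [])) ∷ (1 , (3 ∷ 0 ∷ 3 ∷ 1 ∷ [])) ∷ (1 , (3 ∷ 1 ∷ 0 ∷ 1 ∷ []))
    ∷ (1 , (3 ∷ 1 ∷ 1 ∷ 3 ∷ [])) ∷ (1 , (3 ∷ 1 ∷ 2 ∷ 0 ∷ [])) ∷ (1 , (3 ∷ 2 ∷ 0 ∷ 3 ∷ [])) ∷ (1 , (3 ∷ 2 ∷ 2 ∷ 2 ∷ []))
    ∷ (1 , (3 ∷ 2 ∷ 3 ∷ 0 ∷ [])) ∷ (1 , (3 ∷ 3 ∷ 1 ∷ 2 ∷ [])) ∷ (1 , (3 ∷ 3 ∷ 2 ∷ 1 ∷ [])) ∷ (1 , (3 ∷ 3 ∷ 3 ∷ 3 ∷ []))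
    ∷ (6 , (0 ∷ 0 ∷ 0 ∷ 3 ∷ [])) ∷ (6 , (0 ∷ 0 ∷ 2 ∷ 0 ∷ [])) ∷ (6 , (0 ∷ 0 ∷ 3 ∷ 1 ∷ [])) ∷ (6 , (0 ∷ 1 ∷ 1 ∷ 0 ∷ []))
    ∷ (6 , (0 ∷ 1 ∷ 2 ∷ 2 ∷ [])) ∷ (6 , (0 ∷ 1 ∷ 3 ∷ 3 ∷ [])) ∷ (6 , (0 ∷ 2 ∷ 0 ∷ 2 ∷ [])) ∷ (6 , (0 ∷ 2 ∷ 1 ∷ 3 ∷ []))
    ∷ (6 , (0 ∷ 2 ∷ 2 ∷ 1 ∷ [])) ∷ (6 , (0 ∷ 3 ∷ 0 ∷ 0 ∷ [])) ∷ (6 , (0 ∷ 3 ∷ 1 ∷ 1 ∷ [])) ∷ (6 , (0 ∷ 3 ∷ 3 ∷ 2 ∷ []))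
    ∷ (6 , (1 ∷ 0 ∷ 0 ∷ 2 ∷ [])) ∷ (6 , (1 ∷ 0 ∷ 1 ∷ 3 ∷ [])) ∷ (6 , (1 ∷ 0 ∷ 3 ∷ 0 ∷ [])) ∷ (6 , (1 ∷ 1 ∷ 0 ∷ 0 ∷ []))
    ∷ (6 , (1 ∷ 1 ∷ 1 ∷ 1 ∷ [])) ∷ (6 , (1 ∷ 1 ∷ 2 ∷ 3 ∷ [])) ∷ (6 , (1 ∷ 2 ∷ 1 ∷ 2 ∷ [])) ∷ (6 , (1 ∷ 2 ∷ 2 ∷ 0 ∷ []))
    ∷ (6 , (1 ∷ 2 ∷ 3 ∷ 1 ∷ [])) ∷ (6 , (1 ∷ 3 ∷ 0 ∷ 1 ∷ [])) ∷ (6 , (1 ∷ 3 ∷ 2 ∷ 2 ∷ [])) ∷ (6 , (1 ∷ 3 ∷ 3 ∷ 3 ∷ []))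
    ∷ (6 , (2 ∷ 0 ∷ 0 ∷ 1 ∷ [])) ∷ (6 , (2 ∷ 0 ∷ 1 ∷ 0 ∷ [])) ∷ (6 , (2 ∷ 0 ∷ 2 ∷ 2 ∷ [])) ∷ (6 , (2 ∷ 1 ∷ 0 ∷ 3 ∷ []))
    ∷ (6 , (2 ∷ 1 ∷ 1 ∷ 2 ∷ [])) ∷ (6 , (2 ∷ 1 ∷ 3 ∷ 1 ∷ [])) ∷ (6 , (2 ∷ 2 ∷ 0 ∷ 0 ∷ [])) ∷ (6 , (2 ∷ 2 ∷ 2 ∷ 3 ∷ []))
    ∷ (6 , (2 ∷ 2 ∷ 3 ∷ 2 ∷ [])) ∷ (6 , (2 ∷ 3 ∷ 1 ∷ 3 ∷ [])) ∷ (6 , (2 ∷ 3 ∷ 2 ∷ 1 ∷ [])) ∷ (6 , (2 ∷ 3 ∷ 3 ∷ 0 ∷ []))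
    ∷ (6 , (3 ∷ 0 ∷ 1 ∷ 1 ∷ [])) ∷ (6 , (3 ∷ 0 ∷ 2 ∷ 3 ∷ [])) ∷ (6 , (3 ∷ 0 ∷ 3 ∷ 2 ∷ [])) ∷ (6 , (3 ∷ 1 ∷ 0 ∷ 2 ∷ []))
    ∷ (6 , (3 ∷ 1 ∷ 2 ∷ 1 ∷ [])) ∷ (6 , (3 ∷ 1 ∷ 3 ∷ 0 ∷ [])) ∷ (6 , (3 ∷ 2 ∷ 0 ∷ 1 ∷ [])) ∷ (6 , (3 ∷ 2 ∷ 1 ∷ 0 ∷ []))
    ∷ (6 , (3 ∷ 2 ∷ 3 ∷ 3 ∷ [])) ∷ (6 , (3 ∷ 3 ∷ 0 ∷ 3 ∷ [])) ∷ (6 , (3 ∷ 3 ∷ 1 ∷ 2 ∷ [])) ∷ (6 , (3 ∷ 3 ∷ 2 ∷ 0 ∷ []))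
    ∷ (7 , (0 ∷ 0 ∷ 0 ∷ 0 ∷ [])) ∷ (7 , (0 ∷ 0 ∷ 2 ∷ 1 ∷ [])) ∷ (7 , (0 ∷ 0 ∷ 3 ∷ 2 ∷ [])) ∷ (7 , (0 ∷ 1 ∷ 0 ∷ 3 ∷ []))
    ∷ (7 , (0 ∷ 1 ∷ 1 ∷ 0 ∷ [])) ∷ (7 , (0 ∷ 1 ∷ 2 ∷ 2 ∷ [])) ∷ (7 , (0 ∷ 2 ∷ 1 ∷ 1 ∷ [])) ∷ (7 , (0 ∷ 2 ∷ 2 ∷ 3 ∷ []))
    ∷ (7 , (0 ∷ 2 ∷ 3 ∷ 0 ∷ [])) ∷ (7 , (0 ∷ 3 ∷ 0 ∷ 1 ∷ [])) ∷ (7 , (0 ∷ 3 ∷ 1 ∷ 2 ∷ [])) ∷ (7 , (0 ∷ 3 ∷ 3 ∷ 3 ∷ []))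
    ∷ (7 , (1 ∷ 0 ∷ 1 ∷ 2 ∷ [])) ∷ (7 , (1 ∷ 0 ∷ 2 ∷ 0 ∷ [])) ∷ (7 , (1 ∷ 0 ∷ 3 ∷ 3 ∷ [])) ∷ (7 , (1 ∷ 1 ∷ 0 ∷ 2 ∷ []))
    ∷ (7 , (1 ∷ 1 ∷ 1 ∷ 1 ∷ [])) ∷ (7 , (1 ∷ 1 ∷ 3 ∷ 0 ∷ [])) ∷ (7 , (1 ∷ 2 ∷ 0 ∷ 3 ∷ [])) ∷ (7 , (1 ∷ 2 ∷ 2 ∷ 2 ∷ []))
    ∷ (7 , (1 ∷ 2 ∷ 3 ∷ 1 ∷ [])) ∷ (7 , (1 ∷ 3 ∷ 0 ∷ 0 ∷ [])) ∷ (7 , (1 ∷ 3 ∷ 1 ∷ 3 ∷ [])) ∷ (7 , (1 ∷ 3 ∷ 2 ∷ 1 ∷ []))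
    ∷ (7 , (2 ∷ 0 ∷ 0 ∷ 2 ∷ [])) ∷ (7 , (2 ∷ 0 ∷ 1 ∷ 1 ∷ [])) ∷ (7 , (2 ∷ 0 ∷ 2 ∷ 3 ∷ [])) ∷ (7 , (2 ∷ 1 ∷ 0 ∷ 1 ∷ []))
    ∷ (7 , (2 ∷ 1 ∷ 2 ∷ 0 ∷ [])) ∷ (7 , (2 ∷ 1 ∷ 3 ∷ 3 ∷ [])) ∷ (7 , (2 ∷ 2 ∷ 0 ∷ 0 ∷ [])) ∷ (7 , (2 ∷ 2 ∷ 1 ∷ 3 ∷ []))
    ∷ (7 , (2 ∷ 2 ∷ 3 ∷ 2 ∷ [])) ∷ (7 , (2 ∷ 3 ∷ 1 ∷ 0 ∷ [])) ∷ (7 , (2 ∷ 3 ∷ 2 ∷ 2 ∷ [])) ∷ (7 , (2 ∷ 3 ∷ 3 ∷ 1 ∷ []))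
    ∷ (7 , (3 ∷ 0 ∷ 0 ∷ 3 ∷ [])) ∷ (7 , (3 ∷ 0 ∷ 1 ∷ 0 ∷ [])) ∷ (7 , (3 ∷ 0 ∷ 3 ∷ 1 ∷ [])) ∷ (7 , (3 ∷ 1 ∷ 1 ∷ 3 ∷ []))
    ∷ (7 , (3 ∷ 1 ∷ 2 ∷ 1 ∷ [])) ∷ (7 , (3 ∷ 1 ∷ 3 ∷ 2 ∷ [])) ∷ (7 , (3 ∷ 2 ∷ 0 ∷ 1 ∷ [])) ∷ (7 , (3 ∷ 2 ∷ 1 ∷ 2 ∷ []))
    ∷ (7 , (3 ∷ 2 ∷ 2 ∷ 0 ∷ [])) ∷ (7 , (3 ∷ 3 ∷ 0 ∷ 2 ∷ [])) ∷ (7 , (3 ∷ 3 ∷ 2 ∷ 3 ∷ [])) ∷ (7 , (3 ∷ 3 ∷ 3 ∷ 0 ∷ []))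
    ∷ (9 , (0 ∷ 1 ∷ 1 ∷ 0 ∷ [])) ∷ (9 , (0 ∷ 1 ∷ 2 ∷ 2 ∷ []))
    ∷ []

  vertex : ℕ → Fin 16 × Word 4
  vertex u = fromMaybe (0 , (0 ∷ 0 ∷ 0 ∷ 0 ∷ [])) (head (drop u vertexTable))

open Tables using (codeTable; vertex)

certificate : Refutation ℕ
certificate =
  branch 0 (branch 1 (clash 1 0) (branch 2 (clash 2 0) (clash 2 1) (branch 4 (clash 4 0) (clash 4 1)
  (branch 6 (clash 6 0) (branch 3 (branch 5 (clash 5 3) (branch 7 (clash 7 0) (clash 7 5) (branch 8
  (branch 9 (clash 9 3) (clash 9 1) (branch 10 (clash 10 0) (branch 11 (branch 12 (clash 12 0) (clash
  12 6) (branch 13 (clash 13 0) (branch 14 (branch 15 (clash 15 3) (branch 16 (clash 16 3) (clash 16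
  10) (branch 17 (branch 18 (branch 19 (clash 19 8) (clash 19 1) (branch 20 (clash 20 8) (branch 21
  (branch 22 (clash 22 11) (branch 23 (clash 23 11) (clash 23 5) (branch 24 (clash 24 3) (branch 25
  (clash 25 0) (clash 25 1) (branch 26 (branch 27 (clash 27 3) (clash 27 5) (branch 28 (clash 28 0)
  (branch 29 (branch 30 (branch 31 (clash 31 11) (branch 32 (clash 32 8) (clash 32 6) (branch 33
  (branch 34 (clash 34 11) (clash 34 10) (branch 35 (clash 35 8) (branch 36 (branch 37 (clash 37 11)
  (clash 37 1) (branch 38 (clash 38 0) (branch 39 (branch 40 (clash 40 3) (branch 41 (clash 41 8)
  (clash 41 5) (branch 42 (clash 42 3) (clash 42 6) (branch 43 (clash 43 8) (branch 44 (branch 45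
  (clash 45 11) (branch 46 (clash 46 0) (clash 46 10) (branch 47 (branch 50 (branch 86 (clash 86 50)
  (clash 86 38) (branch 53 (clash 53 50) (branch 51 (clash 51 3) (clash 51 53) (branch 52 (branch 55
  (clash 55 50) (branch 48 (clash 48 50) (clash 48 55) (branch 49 (clash 49 50) (branch 54 (branch 56
  (clash 56 52) (clash 56 49) (branch 57 (clash 57 52) (branch 58 (branch 59 (clash 59 50) (clash 59
  49) (branch 60 (branch 61 (clash 61 58) (branch 62 (clash 62 14) (clash 62 49) (branch 63 (clash 63
  54) (branch 64 (branch 65 (clash 65 52) (clash 65 53) (branch 66 (clash 66 54) (clash 66 55) (branch
  67 (clash 67 52) (branch 68 (branch 69 (clash 69 58) (clash 69 57) (branch 70 (branch 71 (clash 71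
  50) (branch 72 (clash 72 54) (clash 72 49) (branch 73 (branch 74 (clash 74 50) (branch 75 (clash 75
  58) (clash 75 28) (branch 76 (clash 76 52) (branch 77 (branch 78 (clash 78 54) (branch 79 (branch 80
  (clash 80 50) (clash 80 55) (branch 81 (branch 82 (clash 82 58) (branch 83 (clash 83 52) (clash 83
  57) (branch 84 (clash 84 50) (branch 85 (branch 87 (branch 88 (clash 88 52) (branch 89 (clash 89 52)
  (clash 89 49) (branch 90 (clash 90 54) (clash 90 57) (branch 91 (branch 92 (clash 92 54) (branch 93
  (clash 93 58) (clash 93 55) (branch 94 (clash 94 58) (branch 95 (branch 146 (clash 146 50) (branch
  176 (branch 128 (clash 128 176) (branch 116 (clash 116 68) (clash 116 128) (branch 114 (branch 102
  (clash 102 114) (clash 102 128) (branch 103 (clash 103 114) (branch 96 (branch 97 (clash 97 96)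
  (clash 97 49) (branch 98 (clash 98 96) (branch 99 (branch 100 (clash 100 99) (branch 101 (clash 101
  96) (clash 101 98) (branch 104 (branch 105 (clash 105 96) (branch 106 (clash 106 58) (clash 106 98)
  (branch 107 (branch 108 (clash 108 96) (branch 109 (clash 109 96) (clash 109 103) (branch 110
  (branch 111 (clash 111 99) (clash 111 63) (branch 112 (clash 112 99) (branch 113 (branch 115 (clash
  115 104) (branch 117 (branch 118 (clash 118 107) (clash 118 100) (branch 119 (clash 119 107) (branch
  120 (clash 120 96) (clash 120 98) (branch 121 (clash 121 99) (branch 122 (branch 123 (clash 123 96)
  (branch 124 (clash 124 99) (clash 124 100) (branch 125 (branch 126 (branch 127 (clash 127 104)
  (clash 127 103) (branch 129 (branch 130 (clash 130 104) (branch 131 (clash 131 107) (clash 131 105)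
  (branch 132 (branch 133 (clash 133 96) (branch 134 (clash 134 107) (clash 134 98) (branch 135
  (branch 136 (clash 136 104) (clash 136 100) (branch 137 (clash 137 99) (branch 138 (clash 138 104)
  (branch 139 (clash 139 99) (clash 139 103) (branch 140 (branch 141 (clash 141 96) (clash 141 105)
  (branch 142 (clash 142 107) (branch 143 (branch 152 (clash 152 176) (clash 152 146) (branch 144
  (branch 145 (clash 145 144) (clash 145 146) (branch 148 (clash 148 99) (branch 147 (clash 147 144)
  (clash 147 148) (branch 149 (branch 150 (branch 151 (clash 151 149) (branch 153 (clash 153 144)
  (branch 154 (clash 154 149) (clash 154 10) (branch 155 (branch 156 (branch 157 (clash 157 144)
  (branch 158 (clash 158 155) (clash 158 146) (branch 159 (clash 159 149) (branch 160 (clash 160 150)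
  (clash 160 112) (branch 161 (branch 162 (branch 163 (clash 163 149) (clash 163 151) (branch 164
  (clash 164 68) (branch 165 (clash 165 144) (clash 165 153) (branch 166 (clash 166 21) (branch 167
  (branch 168 (clash 168 144) (clash 168 24) (branch 169 (clash 169 150) (branch 170 (branch 171
  (branch 172 (clash 172 149) (clash 172 148) (branch 173 (clash 173 155) (branch 174 (clash 174 126)
  (branch 175 (clash 175 79) (clash 175 151) (branch 177 (branch 178 (clash 178 149) (branch 179
  (clash 179 155) (clash 179 153) (branch 180 (clash 180 36) (branch 181 (clash 181 85) (clash 181
  148) (branch 182 (branch 183 (branch 184 (clash 184 149) (branch 185 (clash 185 149) (clash 185 146)
  (branch 186 (clash 186 150) (clash 186 138) (branch 187 (clash 187 150) (branch 188 (branch 189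
  (branch 190 (clash 190 155) (clash 190 151) (branch 191 (clash 191 155) (branch 192 (clash 192 99)
  (clash 192 148) (branch 193 (clash 193 149) (clash 193 100) (clash 193 192))) (clash 191 152)))
  (clash 189 153) (clash 189 154)) (clash 188 151) (clash 188 152)) (clash 187 154)))) (clash 184
  136)) (clash 183 88) (clash 183 147)) (clash 182 38) (clash 182 86))) (clash 180 147))) (clash 178
  34)) (clash 177 82) (clash 177 154))) (clash 174 152)) (clash 173 147))) (clash 171 153) (clash 171
  147)) (clash 170 151) (clash 170 145)) (clash 169 145))) (clash 167 22) (clash 167 145)) (clash 166
  154))) (clash 164 116))) (clash 162 151) (clash 162 147)) (clash 161 148) (clash 161 152))) (clash
  159 147))) (clash 157 145)) (clash 156 146) (clash 156 154)) (clash 155 146) (clash 155 147)))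
  (clash 153 145)) (clash 151 145)) (clash 150 148) (clash 150 145)) (clash 149 100) (clash 149 145)))
  (clash 148 152))) (clash 144 146) (clash 144 152))) (clash 143 105) (clash 143 97)) (clash 142 93)))
  (clash 140 103) (clash 140 101))) (clash 138 102)) (clash 137 101))) (clash 135 100) (clash 135
  102))) (clash 133 97)) (clash 132 98) (clash 132 106))) (clash 130 106)) (clash 129 103) (clash 129
  106))) (clash 126 105) (clash 126 102)) (clash 125 98) (clash 125 101))) (clash 123 101)) (clash 122
  100) (clash 122 97)) (clash 121 97))) (clash 119 101))) (clash 117 105) (clash 117 69)) (clash 115
  97)) (clash 113 100) (clash 113 101)) (clash 112 106))) (clash 110 98) (clash 110 97))) (clash 108
  102)) (clash 107 98) (clash 107 101))) (clash 105 97)) (clash 104 98) (clash 104 56))) (clash 100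
  97)) (clash 99 103) (clash 99 97)) (clash 98 97))) (clash 96 103) (clash 96 102)) (clash 103 102)))
  (clash 114 128) (clash 114 116))) (clash 128 80)) (clash 176 146) (clash 176 80)) (clash 146 2))
  (clash 95 57) (clash 95 59)) (clash 94 56))) (clash 92 59)) (clash 91 55) (clash 91 56)))) (clash 88
  48)) (clash 87 53) (clash 87 51)) (clash 85 49) (clash 85 48)) (clash 84 51))) (clash 82 59)) (clash
  81 57) (clash 81 51))) (clash 79 55) (clash 79 48)) (clash 78 56)) (clash 77 53) (clash 77 59))
  (clash 76 51))) (clash 74 48)) (clash 73 49) (clash 73 56))) (clash 71 59)) (clash 70 49) (clash 70
  59))) (clash 68 53) (clash 68 56)) (clash 67 19)))) (clash 64 55) (clash 64 16)) (clash 63 51)))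
  (clash 61 48)) (clash 60 57) (clash 60 48))) (clash 58 53) (clash 58 48)) (clash 57 9))) (clash 54
  49) (clash 54 51)) (clash 49 48))) (clash 55 51)) (clash 52 53) (clash 52 51))) (clash 53 86)))
  (branch 51 (clash 51 3) (clash 51 50) (branch 53 (branch 52 (clash 52 53) (branch 55 (branch 48
  (clash 48 55) (clash 48 50) (branch 49 (branch 54 (clash 54 49) (branch 56 (clash 56 49) (clash 56
  52) (branch 57 (branch 58 (clash 58 53) (branch 59 (clash 59 49) (clash 59 50) (branch 60 (clash 60
  57) (branch 61 (branch 62 (clash 62 14) (clash 62 50) (branch 63 (branch 64 (clash 64 55) (branch 65
  (clash 65 53) (clash 65 52) (branch 66 (clash 66 55) (clash 66 54) (branch 67 (branch 68 (clash 68
  53) (branch 69 (clash 69 57) (clash 69 58) (branch 70 (clash 70 49) (branch 71 (branch 72 (clash 72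
  49) (clash 72 54) (branch 73 (clash 73 49) (branch 74 (branch 75 (clash 75 53) (clash 75 28) (branch
  76 (branch 77 (clash 77 53) (branch 78 (branch 79 (clash 79 55) (branch 80 (clash 80 55) (clash 80
  50) (branch 81 (clash 81 57) (branch 82 (branch 83 (clash 83 57) (clash 83 52) (branch 84 (branch 85
  (clash 85 49) (branch 86 (clash 86 53) (clash 86 38) (branch 87 (clash 87 53) (branch 88 (branch 89
  (clash 89 49) (clash 89 52) (branch 90 (clash 90 57) (clash 90 54) (branch 91 (clash 91 55) (branch
  92 (branch 93 (clash 93 55) (clash 93 58) (branch 94 (branch 95 (clash 95 57) (branch 146 (branch
  154 (clash 154 146) (clash 154 10) (branch 149 (clash 149 146) (branch 145 (clash 145 146) (clash
  145 149) (branch 144 (clash 144 146) (branch 148 (branch 147 (clash 147 148) (clash 147 144) (branch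
  150 (clash 150 148) (branch 151 (branch 152 (clash 152 146) (clash 152 144) (branch 153 (branch 155
  (clash 155 146) (branch 156 (clash 156 146) (branch 157 (branch 158 (clash 158 146) (clash 158 155)
  (branch 159 (branch 160 (clash 160 148) (clash 160 150) (branch 161 (clash 161 148) (branch 162
  (clash 162 151) (branch 163 (clash 163 151) (clash 163 149) (branch 164 (branch 116 (clash 116 164)
  (clash 116 68) (branch 165 (clash 165 153) (clash 165 144) (branch 166 (clash 166 21) (clash 166
  155) (clash 166 154)))) (clash 164 68) (clash 164 152))) (clash 162 147)) (clash 161 152))) (clash
  159 149) (clash 159 147))) (clash 157 144) (clash 157 145)) (clash 156 154)) (clash 155 147)) (clash
  153 144) (clash 153 145))) (clash 151 149) (clash 151 145)) (clash 150 145))) (clash 148 144) (clash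
  148 154)) (clash 144 145))) (clash 149 154))) (clash 146 50) (clash 146 2)) (clash 95 59)) (clash 94
  58) (clash 94 56))) (clash 92 54) (clash 92 59)) (clash 91 56)))) (clash 88 52) (clash 88 48))
  (clash 87 51))) (clash 85 48)) (clash 84 50) (clash 84 51))) (clash 82 58) (clash 82 59)) (clash 81
  51))) (clash 79 48)) (clash 78 54) (clash 78 56)) (clash 77 59)) (clash 76 52) (clash 76 51)))
  (clash 74 50) (clash 74 48)) (clash 73 56))) (clash 71 50) (clash 71 59)) (clash 70 59))) (clash 68
  56)) (clash 67 52) (clash 67 19)))) (clash 64 16)) (clash 63 54) (clash 63 51))) (clash 61 58)
  (clash 61 48)) (clash 60 48))) (clash 58 48)) (clash 57 52) (clash 57 9))) (clash 54 51)) (clash 49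
  50) (clash 49 48))) (clash 55 50) (clash 55 51)) (clash 52 51)) (clash 53 50) (clash 53 51))) (clash
  50 2)) (clash 47 10) (clash 47 2))) (clash 45 9)) (clash 44 6) (clash 44 4)) (clash 43 7)))) (clash
  40 4)) (clash 39 5) (clash 39 7)) (clash 38 2))) (clash 36 1) (clash 36 9)) (clash 35 9))) (clash 33
  6) (clash 33 9))) (clash 31 7)) (clash 30 10) (clash 30 7)) (clash 29 1) (clash 29 4)) (clash 28
  4))) (clash 26 5) (clash 26 2))) (clash 24 2))) (clash 22 4)) (clash 21 10) (clash 21 9)) (clash 20
  2))) (clash 18 6) (clash 18 7)) (clash 17 5) (clash 17 4))) (clash 15 9)) (clash 14 1) (clash 14 2))
  (clash 13 7))) (clash 11 1) (clash 11 4)) (clash 10 2))) (clash 8 1) (clash 8 2))) (clash 5 2))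
  (clash 3 6) (clash 3 2)) (clash 6 4)))) (branch 2 (clash 2 0) (branch 4 (clash 4 0) (branch 6 (clash
  6 0) (clash 6 4) (branch 3 (branch 5 (clash 5 3) (clash 5 2) (branch 7 (clash 7 0) (branch 8 (branch
  9 (clash 9 3) (branch 10 (clash 10 0) (clash 10 2) (branch 11 (branch 12 (clash 12 0) (branch 13
  (clash 13 0) (clash 13 7) (branch 14 (branch 15 (clash 15 3) (clash 15 9) (branch 16 (clash 16 3)
  (branch 17 (branch 18 (branch 19 (clash 19 8) (branch 20 (clash 20 8) (clash 20 2) (branch 21
  (branch 22 (clash 22 11) (clash 22 4) (branch 23 (clash 23 11) (branch 24 (clash 24 3) (clash 24 2)
  (branch 25 (clash 25 0) (branch 26 (branch 27 (clash 27 3) (branch 28 (clash 28 0) (clash 28 4)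
  (branch 29 (branch 30 (branch 31 (clash 31 11) (clash 31 7) (branch 32 (clash 32 8) (branch 33
  (branch 34 (clash 34 11) (branch 35 (clash 35 8) (clash 35 9) (branch 36 (branch 37 (clash 37 11)
  (branch 38 (clash 38 0) (clash 38 2) (branch 39 (branch 40 (clash 40 3) (clash 40 4) (branch 41
  (clash 41 8) (branch 42 (clash 42 3) (branch 43 (clash 43 8) (clash 43 7) (branch 44 (branch 45
  (clash 45 11) (clash 45 9) (branch 46 (clash 46 0) (branch 47 (branch 50 (branch 86 (clash 86 50)
  (branch 53 (clash 53 50) (clash 53 86) (branch 51 (clash 51 3) (branch 52 (branch 55 (clash 55 50)
  (clash 55 51) (branch 48 (clash 48 50) (branch 49 (clash 49 50) (clash 49 48) (branch 54 (branch 56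
  (clash 56 52) (branch 57 (clash 57 52) (clash 57 9) (branch 58 (branch 59 (clash 59 50) (branch 60
  (branch 61 (clash 61 58) (clash 61 48) (branch 62 (clash 62 14) (branch 63 (clash 63 54) (clash 63
  51) (branch 64 (branch 65 (clash 65 52) (branch 66 (clash 66 54) (branch 67 (clash 67 52) (clash 67
  19) (branch 68 (branch 69 (clash 69 58) (branch 70 (branch 71 (clash 71 50) (clash 71 59) (branch 72
  (clash 72 54) (branch 73 (branch 74 (clash 74 50) (clash 74 48) (branch 75 (clash 75 58) (branch 76
  (clash 76 52) (clash 76 51) (branch 77 (branch 78 (clash 78 54) (clash 78 56) (branch 79 (branch 80
  (clash 80 50) (branch 81 (branch 82 (clash 82 58) (clash 82 59) (branch 83 (clash 83 52) (branch 84
  (clash 84 50) (clash 84 51) (branch 85 (branch 87 (branch 88 (clash 88 52) (clash 88 48) (branch 89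
  (clash 89 52) (branch 90 (clash 90 54) (branch 91 (branch 92 (clash 92 54) (clash 92 59) (branch 93
  (clash 93 58) (branch 94 (clash 94 58) (clash 94 56) (branch 95 (branch 146 (clash 146 50) (clash
  146 2) (branch 176 (branch 128 (clash 128 176) (clash 128 80) (branch 116 (clash 116 68) (branch 114
  (branch 102 (clash 102 114) (branch 103 (clash 103 114) (clash 103 102) (branch 96 (branch 97 (clash
  97 96) (branch 98 (clash 98 96) (clash 98 97) (branch 99 (branch 100 (clash 100 99) (clash 100 97)
  (branch 101 (clash 101 96) (branch 104 (branch 105 (clash 105 96) (clash 105 97) (branch 106 (clash
  106 58) (branch 107 (branch 108 (clash 108 96) (clash 108 102) (branch 109 (clash 109 96) (branch
  110 (branch 111 (clash 111 99) (branch 112 (clash 112 99) (clash 112 106) (branch 113 (branch 115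
  (clash 115 104) (clash 115 97) (branch 117 (branch 118 (clash 118 107) (branch 119 (clash 119 107)
  (clash 119 101) (branch 120 (clash 120 96) (branch 121 (clash 121 99) (clash 121 97) (branch 122
  (branch 123 (clash 123 96) (clash 123 101) (branch 124 (clash 124 99) (branch 125 (branch 126
  (branch 127 (clash 127 104) (branch 129 (branch 130 (clash 130 104) (clash 130 106) (branch 131
  (clash 131 107) (branch 132 (branch 133 (clash 133 96) (clash 133 97) (branch 134 (clash 134 107)
  (branch 135 (branch 136 (clash 136 104) (branch 137 (clash 137 99) (clash 137 101) (branch 138
  (clash 138 104) (clash 138 102) (branch 139 (clash 139 99) (branch 140 (branch 141 (clash 141 96)
  (branch 142 (clash 142 107) (clash 142 93) (branch 143 (branch 152 (clash 152 176) (branch 144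
  (branch 145 (clash 145 144) (branch 148 (clash 148 99) (clash 148 152) (branch 147 (clash 147 144)
  (branch 149 (branch 150 (branch 151 (clash 151 149) (clash 151 145) (branch 153 (clash 153 144)
  (clash 153 145) (branch 154 (clash 154 149) (branch 155 (branch 156 (branch 157 (clash 157 144)
  (clash 157 145) (branch 158 (clash 158 155) (branch 159 (clash 159 149) (clash 159 147) (branch 160
  (clash 160 150) (branch 161 (branch 162 (branch 163 (clash 163 149) (branch 164 (clash 164 68)
  (clash 164 116) (branch 165 (clash 165 144) (branch 166 (clash 166 21) (clash 166 154) (branch 167
  (branch 168 (clash 168 144) (branch 169 (clash 169 150) (clash 169 145) (branch 170 (branch 171
  (branch 172 (clash 172 149) (branch 173 (clash 173 155) (clash 173 147) (branch 174 (clash 174 126)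
  (clash 174 152) (branch 175 (clash 175 79) (branch 177 (branch 178 (clash 178 149) (clash 178 34)
  (branch 179 (clash 179 155) (branch 180 (clash 180 36) (clash 180 147) (branch 181 (clash 181 85)
  (branch 182 (branch 183 (branch 184 (clash 184 149) (clash 184 136) (branch 185 (clash 185 149)
  (branch 186 (clash 186 150) (branch 187 (clash 187 150) (clash 187 154) (branch 188 (branch 189
  (branch 190 (clash 190 155) (branch 191 (clash 191 155) (clash 191 152) (branch 192 (clash 192 99)
  (branch 193 (clash 193 149) (clash 193 192) (clash 193 100)) (clash 192 148))) (clash 190 151))
  (clash 189 154) (clash 189 153)) (clash 188 152) (clash 188 151))) (clash 186 138)) (clash 185
  146))) (clash 183 147) (clash 183 88)) (clash 182 86) (clash 182 38)) (clash 181 148))) (clash 179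
  153))) (clash 177 154) (clash 177 82)) (clash 175 151)))) (clash 172 148)) (clash 171 147) (clash
  171 153)) (clash 170 145) (clash 170 151))) (clash 168 24)) (clash 167 145) (clash 167 22))) (clash
  165 153))) (clash 163 151)) (clash 162 147) (clash 162 151)) (clash 161 152) (clash 161 148)) (clash
  160 112))) (clash 158 146))) (clash 156 154) (clash 156 146)) (clash 155 147) (clash 155 146))
  (clash 154 10)))) (clash 150 145) (clash 150 148)) (clash 149 145) (clash 149 100)) (clash 147
  148))) (clash 145 146)) (clash 144 152) (clash 144 146)) (clash 152 146)) (clash 143 97) (clash 143
  105))) (clash 141 105)) (clash 140 101) (clash 140 103)) (clash 139 103)))) (clash 136 100)) (clash
  135 102) (clash 135 100)) (clash 134 98))) (clash 132 106) (clash 132 98)) (clash 131 105))) (clash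
  129 106) (clash 129 103)) (clash 127 103)) (clash 126 102) (clash 126 105)) (clash 125 101) (clash
  125 98)) (clash 124 100))) (clash 122 97) (clash 122 100))) (clash 120 98))) (clash 118 100)) (clash
  117 69) (clash 117 105))) (clash 113 101) (clash 113 100))) (clash 111 63)) (clash 110 97) (clash
  110 98)) (clash 109 103))) (clash 107 101) (clash 107 98)) (clash 106 98))) (clash 104 56) (clash
  104 98)) (clash 101 98))) (clash 99 97) (clash 99 103))) (clash 97 49)) (clash 96 102) (clash 96
  103))) (clash 102 128)) (clash 114 116) (clash 114 128)) (clash 116 128))) (clash 176 80) (clash 176
  146))) (clash 95 59) (clash 95 57))) (clash 93 55))) (clash 91 56) (clash 91 55)) (clash 90 57))
  (clash 89 49))) (clash 87 51) (clash 87 53)) (clash 85 48) (clash 85 49))) (clash 83 57))) (clash 81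
  51) (clash 81 57)) (clash 80 55)) (clash 79 48) (clash 79 55))) (clash 77 59) (clash 77 53))) (clash
  75 28))) (clash 73 56) (clash 73 49)) (clash 72 49))) (clash 70 59) (clash 70 49)) (clash 69 57))
  (clash 68 56) (clash 68 53))) (clash 66 55)) (clash 65 53)) (clash 64 16) (clash 64 55))) (clash 62
  49))) (clash 60 48) (clash 60 57)) (clash 59 49)) (clash 58 48) (clash 58 53))) (clash 56 49))
  (clash 54 51) (clash 54 49))) (clash 48 55))) (clash 52 51) (clash 52 53)) (clash 51 53))) (clash 86
  38)) (clash 50 2) (branch 51 (clash 51 3) (branch 53 (branch 52 (clash 52 53) (clash 52 51) (branch
  55 (branch 48 (clash 48 55) (branch 49 (branch 54 (clash 54 49) (clash 54 51) (branch 56 (clash 56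
  49) (branch 57 (branch 58 (clash 58 53) (clash 58 48) (branch 59 (clash 59 49) (branch 60 (clash 60
  57) (clash 60 48) (branch 61 (branch 62 (clash 62 14) (branch 63 (branch 64 (clash 64 55) (clash 64
  16) (branch 65 (clash 65 53) (branch 66 (clash 66 55) (branch 67 (branch 68 (clash 68 53) (clash 68
  56) (branch 69 (clash 69 57) (branch 70 (clash 70 49) (clash 70 59) (branch 71 (branch 72 (clash 72
  49) (branch 73 (clash 73 49) (clash 73 56) (branch 74 (branch 75 (clash 75 53) (branch 76 (branch 77
  (clash 77 53) (clash 77 59) (branch 78 (branch 79 (clash 79 55) (clash 79 48) (branch 80 (clash 80
  55) (branch 81 (clash 81 57) (clash 81 51) (branch 82 (branch 83 (clash 83 57) (branch 84 (branch 85
  (clash 85 49) (clash 85 48) (branch 86 (clash 86 53) (branch 87 (clash 87 53) (clash 87 51) (branch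
  88 (branch 89 (clash 89 49) (branch 90 (clash 90 57) (branch 91 (clash 91 55) (clash 91 56) (branch
  92 (branch 93 (clash 93 55) (branch 94 (branch 95 (clash 95 57) (clash 95 59) (branch 146 (branch
  154 (clash 154 146) (branch 149 (clash 149 146) (clash 149 154) (branch 145 (clash 145 146) (branch
  144 (clash 144 146) (clash 144 145) (branch 148 (branch 147 (clash 147 148) (branch 150 (clash 150
  148) (clash 150 145) (branch 151 (branch 152 (clash 152 146) (branch 153 (branch 155 (clash 155 146)
  (clash 155 147) (branch 156 (clash 156 146) (clash 156 154) (branch 157 (branch 158 (clash 158 146)
  (branch 159 (branch 160 (clash 160 148) (branch 161 (clash 161 148) (clash 161 152) (branch 162
  (clash 162 151) (clash 162 147) (branch 163 (clash 163 151) (branch 164 (branch 116 (clash 116 164)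
  (branch 165 (clash 165 153) (branch 166 (clash 166 21) (clash 166 154) (clash 166 155)) (clash 165
  144)) (clash 116 68)) (clash 164 152) (clash 164 68)) (clash 163 149)))) (clash 160 150)) (clash 159
  147) (clash 159 149)) (clash 158 155)) (clash 157 145) (clash 157 144)))) (clash 153 145) (clash 153
  144)) (clash 152 144)) (clash 151 145) (clash 151 149))) (clash 147 144)) (clash 148 154) (clash 148
  144))) (clash 145 149))) (clash 154 10)) (clash 146 2) (clash 146 50))) (clash 94 56) (clash 94 58))
  (clash 93 58)) (clash 92 59) (clash 92 54))) (clash 90 54)) (clash 89 52)) (clash 88 48) (clash 88
  52))) (clash 86 38))) (clash 84 51) (clash 84 50)) (clash 83 52)) (clash 82 59) (clash 82 58)))
  (clash 80 50))) (clash 78 56) (clash 78 54))) (clash 76 51) (clash 76 52)) (clash 75 28)) (clash 74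
  48) (clash 74 50))) (clash 72 54)) (clash 71 59) (clash 71 50))) (clash 69 58))) (clash 67 19)
  (clash 67 52)) (clash 66 54)) (clash 65 52))) (clash 63 51) (clash 63 54)) (clash 62 50)) (clash 61
  48) (clash 61 58))) (clash 59 50))) (clash 57 9) (clash 57 52)) (clash 56 52))) (clash 49 48) (clash
  49 50)) (clash 48 50)) (clash 55 51) (clash 55 50))) (clash 53 51) (clash 53 50)) (clash 51 50)))
  (clash 47 2) (clash 47 10)) (clash 46 10))) (clash 44 4) (clash 44 6))) (clash 42 6)) (clash 41 5)))
  (clash 39 7) (clash 39 5))) (clash 37 1)) (clash 36 9) (clash 36 1))) (clash 34 10)) (clash 33 9)
  (clash 33 6)) (clash 32 6))) (clash 30 7) (clash 30 10)) (clash 29 4) (clash 29 1))) (clash 27 5))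
  (clash 26 2) (clash 26 5)) (clash 25 1))) (clash 23 5))) (clash 21 9) (clash 21 10))) (clash 19 1))
  (clash 18 7) (clash 18 6)) (clash 17 4) (clash 17 5)) (clash 16 10))) (clash 14 2) (clash 14 1)))
  (clash 12 6)) (clash 11 4) (clash 11 1))) (clash 9 1)) (clash 8 2) (clash 8 1)) (clash 7 5))) (clash
  3 2) (clash 3 6))) (clash 4 1)) (clash 2 1))) (branch 1 (branch 2 (clash 2 1) (clash 2 0) (branch 4
  (clash 4 1) (clash 4 0) (branch 6 (branch 3 (clash 3 6) (branch 5 (branch 7 (clash 7 5) (clash 7 0)
  (branch 8 (clash 8 1) (branch 9 (clash 9 1) (clash 9 3) (branch 10 (branch 11 (clash 11 1) (branch
  12 (clash 12 6) (clash 12 0) (branch 13 (branch 14 (clash 14 1) (branch 15 (branch 16 (clash 16 10)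
  (clash 16 3) (branch 17 (clash 17 5) (branch 18 (clash 18 6) (branch 19 (clash 19 1) (clash 19 8)
  (branch 20 (branch 21 (clash 21 10) (branch 22 (branch 23 (clash 23 5) (clash 23 11) (branch 24
  (branch 25 (clash 25 1) (clash 25 0) (branch 26 (clash 26 5) (branch 27 (clash 27 5) (clash 27 3)
  (branch 28 (branch 29 (clash 29 1) (branch 30 (clash 30 10) (branch 31 (branch 32 (clash 32 6)
  (clash 32 8) (branch 33 (clash 33 6) (branch 34 (clash 34 10) (clash 34 11) (branch 35 (branch 36
  (clash 36 1) (branch 37 (clash 37 1) (clash 37 11) (branch 38 (branch 39 (clash 39 5) (branch 40
  (branch 41 (clash 41 5) (clash 41 8) (branch 42 (clash 42 6) (clash 42 3) (branch 43 (branch 44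
  (clash 44 6) (branch 45 (branch 46 (clash 46 10) (clash 46 0) (branch 47 (clash 47 10) (branch 50
  (branch 51 (clash 51 50) (clash 51 3) (branch 53 (clash 53 50) (branch 52 (branch 55 (clash 55 50)
  (branch 48 (clash 48 50) (clash 48 55) (branch 49 (clash 49 50) (branch 54 (branch 56 (clash 56 52)
  (clash 56 49) (branch 57 (clash 57 52) (branch 58 (branch 59 (clash 59 50) (clash 59 49) (branch 60
  (branch 61 (clash 61 58) (branch 62 (clash 62 50) (clash 62 14) (branch 63 (clash 63 54) (branch 64
  (branch 65 (clash 65 52) (clash 65 53) (branch 66 (clash 66 54) (clash 66 55) (branch 67 (clash 67
  52) (branch 68 (branch 69 (clash 69 58) (clash 69 57) (branch 70 (branch 71 (clash 71 50) (branch 72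
  (clash 72 54) (clash 72 49) (branch 73 (branch 74 (clash 74 50) (branch 75 (clash 75 28) (clash 75
  53) (branch 76 (clash 76 52) (branch 77 (branch 78 (clash 78 54) (branch 79 (branch 80 (clash 80 50)
  (clash 80 55) (branch 81 (branch 82 (clash 82 58) (branch 83 (clash 83 52) (clash 83 57) (branch 84
  (clash 84 50) (branch 85 (branch 86 (clash 86 38) (clash 86 53) (branch 87 (branch 88 (clash 88 52)
  (branch 89 (clash 89 52) (clash 89 49) (branch 90 (clash 90 54) (clash 90 57) (branch 91 (branch 92
  (clash 92 54) (branch 93 (clash 93 58) (clash 93 55) (branch 94 (clash 94 58) (branch 95 (branch 146
  (clash 146 50) (branch 154 (clash 154 10) (clash 154 146) (branch 149 (branch 145 (clash 145 149)
  (clash 145 146) (branch 144 (branch 148 (clash 148 144) (branch 147 (clash 147 144) (clash 147 148)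
  (branch 150 (branch 151 (clash 151 149) (branch 152 (clash 152 144) (clash 152 146) (branch 153
  (clash 153 144) (branch 155 (branch 156 (branch 157 (clash 157 144) (branch 158 (clash 158 155)
  (clash 158 146) (branch 159 (clash 159 149) (branch 160 (clash 160 150) (clash 160 148) (branch 161
  (branch 162 (branch 163 (clash 163 149) (clash 163 151) (branch 164 (clash 164 68) (branch 116
  (clash 116 68) (clash 116 164) (branch 165 (clash 165 144) (clash 165 153) (branch 166 (clash 166
  155) (clash 166 21) (clash 166 154)))) (clash 164 152))) (clash 162 151) (clash 162 147)) (clash 161
  148) (clash 161 152))) (clash 159 147))) (clash 157 145)) (clash 156 146) (clash 156 154)) (clash
  155 146) (clash 155 147)) (clash 153 145))) (clash 151 145)) (clash 150 148) (clash 150 145)))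
  (clash 148 154)) (clash 144 146) (clash 144 145))) (clash 149 146) (clash 149 154))) (clash 146 2))
  (clash 95 57) (clash 95 59)) (clash 94 56))) (clash 92 59)) (clash 91 55) (clash 91 56)))) (clash 88
  48)) (clash 87 53) (clash 87 51))) (clash 85 49) (clash 85 48)) (clash 84 51))) (clash 82 59))
  (clash 81 57) (clash 81 51))) (clash 79 55) (clash 79 48)) (clash 78 56)) (clash 77 53) (clash 77
  59)) (clash 76 51))) (clash 74 48)) (clash 73 49) (clash 73 56))) (clash 71 59)) (clash 70 49)
  (clash 70 59))) (clash 68 53) (clash 68 56)) (clash 67 19)))) (clash 64 55) (clash 64 16)) (clash 63
  51))) (clash 61 48)) (clash 60 57) (clash 60 48))) (clash 58 53) (clash 58 48)) (clash 57 9)))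
  (clash 54 49) (clash 54 51)) (clash 49 48))) (clash 55 51)) (clash 52 53) (clash 52 51)) (clash 53
  51))) (branch 86 (clash 86 38) (clash 86 50) (branch 53 (branch 51 (clash 51 53) (clash 51 3)
  (branch 52 (clash 52 53) (branch 55 (branch 48 (clash 48 55) (clash 48 50) (branch 49 (branch 54
  (clash 54 49) (branch 56 (clash 56 49) (clash 56 52) (branch 57 (branch 58 (clash 58 53) (branch 59
  (clash 59 49) (clash 59 50) (branch 60 (clash 60 57) (branch 61 (branch 62 (clash 62 49) (clash 62
  14) (branch 63 (branch 64 (clash 64 55) (branch 65 (clash 65 53) (clash 65 52) (branch 66 (clash 66
  55) (clash 66 54) (branch 67 (branch 68 (clash 68 53) (branch 69 (clash 69 57) (clash 69 58) (branch
  70 (clash 70 49) (branch 71 (branch 72 (clash 72 49) (clash 72 54) (branch 73 (clash 73 49) (branch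
  74 (branch 75 (clash 75 28) (clash 75 58) (branch 76 (branch 77 (clash 77 53) (branch 78 (branch 79
  (clash 79 55) (branch 80 (clash 80 55) (clash 80 50) (branch 81 (clash 81 57) (branch 82 (branch 83
  (clash 83 57) (clash 83 52) (branch 84 (branch 85 (clash 85 49) (branch 87 (clash 87 53) (branch 88
  (branch 89 (clash 89 49) (clash 89 52) (branch 90 (clash 90 57) (clash 90 54) (branch 91 (clash 91
  55) (branch 92 (branch 93 (clash 93 55) (clash 93 58) (branch 94 (branch 95 (clash 95 57) (branch
  146 (branch 176 (clash 176 146) (branch 128 (branch 116 (clash 116 128) (clash 116 68) (branch 114
  (clash 114 128) (branch 102 (clash 102 128) (clash 102 114) (branch 103 (branch 96 (clash 96 103)
  (branch 97 (clash 97 49) (clash 97 96) (branch 98 (branch 99 (clash 99 103) (branch 100 (branch 101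
  (clash 101 98) (clash 101 96) (branch 104 (clash 104 98) (branch 105 (branch 106 (clash 106 98)
  (clash 106 58) (branch 107 (clash 107 98) (branch 108 (branch 109 (clash 109 103) (clash 109 96)
  (branch 110 (clash 110 98) (branch 111 (clash 111 63) (clash 111 99) (branch 112 (branch 113 (clash
  113 100) (branch 115 (branch 117 (clash 117 105) (branch 118 (clash 118 100) (clash 118 107) (branch
  119 (branch 120 (clash 120 98) (clash 120 96) (branch 121 (branch 122 (clash 122 100) (branch 123
  (branch 124 (clash 124 100) (clash 124 99) (branch 125 (clash 125 98) (branch 126 (clash 126 105)
  (branch 127 (clash 127 103) (clash 127 104) (branch 129 (clash 129 103) (branch 130 (branch 131
  (clash 131 105) (clash 131 107) (branch 132 (clash 132 98) (branch 133 (branch 134 (clash 134 98)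
  (clash 134 107) (branch 135 (clash 135 100) (branch 136 (clash 136 100) (clash 136 104) (branch 137
  (branch 138 (branch 139 (clash 139 103) (clash 139 99) (branch 140 (clash 140 103) (branch 141
  (clash 141 105) (clash 141 96) (branch 142 (branch 143 (clash 143 105) (branch 152 (clash 152 146)
  (clash 152 176) (branch 144 (clash 144 146) (branch 145 (clash 145 146) (clash 145 144) (branch 148
  (branch 147 (clash 147 148) (clash 147 144) (branch 149 (clash 149 100) (branch 150 (clash 150 148)
  (branch 151 (branch 153 (branch 154 (clash 154 10) (clash 154 149) (branch 155 (clash 155 146)
  (branch 156 (clash 156 146) (branch 157 (branch 158 (clash 158 146) (clash 158 155) (branch 159
  (branch 160 (clash 160 112) (clash 160 150) (branch 161 (clash 161 148) (branch 162 (clash 162 151)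
  (branch 163 (clash 163 151) (clash 163 149) (branch 164 (branch 165 (clash 165 153) (clash 165 144)
  (branch 166 (branch 167 (clash 167 22) (branch 168 (clash 168 24) (clash 168 144) (branch 169
  (branch 170 (clash 170 151) (branch 171 (clash 171 153) (branch 172 (clash 172 148) (clash 172 149)
  (branch 173 (branch 174 (branch 175 (clash 175 151) (clash 175 79) (branch 177 (clash 177 82)
  (branch 178 (branch 179 (clash 179 153) (clash 179 155) (branch 180 (branch 181 (clash 181 148)
  (clash 181 85) (branch 182 (clash 182 38) (branch 183 (clash 183 88) (branch 184 (branch 185 (clash
  185 146) (clash 185 149) (branch 186 (clash 186 138) (clash 186 150) (branch 187 (branch 188 (clash
  188 151) (branch 189 (clash 189 153) (branch 190 (clash 190 151) (clash 190 155) (branch 191 (branch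
  192 (clash 192 148) (clash 192 99) (branch 193 (clash 193 100) (clash 193 149) (clash 193 192)))
  (clash 191 155) (clash 191 152))) (clash 189 154)) (clash 188 152)) (clash 187 150) (clash 187
  154)))) (clash 184 149) (clash 184 136)) (clash 183 147)) (clash 182 86))) (clash 180 36) (clash 180
  147))) (clash 178 149) (clash 178 34)) (clash 177 154))) (clash 174 126) (clash 174 152)) (clash 173
  155) (clash 173 147))) (clash 171 147)) (clash 170 145)) (clash 169 150) (clash 169 145))) (clash
  167 145)) (clash 166 21) (clash 166 154))) (clash 164 68) (clash 164 116))) (clash 162 147)) (clash
  161 152))) (clash 159 149) (clash 159 147))) (clash 157 144) (clash 157 145)) (clash 156 154))
  (clash 155 147))) (clash 153 144) (clash 153 145)) (clash 151 149) (clash 151 145)) (clash 150 145))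
  (clash 149 145))) (clash 148 99) (clash 148 152))) (clash 144 152))) (clash 143 97)) (clash 142 107)
  (clash 142 93))) (clash 140 101))) (clash 138 104) (clash 138 102)) (clash 137 99) (clash 137 101)))
  (clash 135 102))) (clash 133 96) (clash 133 97)) (clash 132 106))) (clash 130 104) (clash 130 106))
  (clash 129 106))) (clash 126 102)) (clash 125 101))) (clash 123 96) (clash 123 101)) (clash 122 97))
  (clash 121 99) (clash 121 97))) (clash 119 107) (clash 119 101))) (clash 117 69)) (clash 115 104)
  (clash 115 97)) (clash 113 101)) (clash 112 99) (clash 112 106))) (clash 110 97))) (clash 108 96)
  (clash 108 102)) (clash 107 101))) (clash 105 96) (clash 105 97)) (clash 104 56))) (clash 100 99)
  (clash 100 97)) (clash 99 97)) (clash 98 96) (clash 98 97))) (clash 96 102)) (clash 103 114) (clash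
  103 102))) (clash 114 116))) (clash 128 176) (clash 128 80)) (clash 176 80)) (clash 146 50) (clash
  146 2)) (clash 95 59)) (clash 94 58) (clash 94 56))) (clash 92 54) (clash 92 59)) (clash 91 56))))
  (clash 88 52) (clash 88 48)) (clash 87 51)) (clash 85 48)) (clash 84 50) (clash 84 51))) (clash 82
  58) (clash 82 59)) (clash 81 51))) (clash 79 48)) (clash 78 54) (clash 78 56)) (clash 77 59)) (clash
  76 52) (clash 76 51))) (clash 74 50) (clash 74 48)) (clash 73 56))) (clash 71 50) (clash 71 59))
  (clash 70 59))) (clash 68 56)) (clash 67 52) (clash 67 19)))) (clash 64 16)) (clash 63 54) (clash 63
  51))) (clash 61 58) (clash 61 48)) (clash 60 48))) (clash 58 48)) (clash 57 52) (clash 57 9)))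
  (clash 54 51)) (clash 49 50) (clash 49 48))) (clash 55 50) (clash 55 51)) (clash 52 51))) (clash 53
  50) (clash 53 86))) (clash 50 2)) (clash 47 2))) (clash 45 11) (clash 45 9)) (clash 44 4)) (clash 43
  8) (clash 43 7)))) (clash 40 3) (clash 40 4)) (clash 39 7)) (clash 38 0) (clash 38 2))) (clash 36
  9)) (clash 35 8) (clash 35 9))) (clash 33 9))) (clash 31 11) (clash 31 7)) (clash 30 7)) (clash 29
  4)) (clash 28 0) (clash 28 4))) (clash 26 2))) (clash 24 3) (clash 24 2))) (clash 22 11) (clash 22
  4)) (clash 21 9)) (clash 20 8) (clash 20 2))) (clash 18 7)) (clash 17 4))) (clash 15 3) (clash 15
  9)) (clash 14 2)) (clash 13 0) (clash 13 7))) (clash 11 4)) (clash 10 0) (clash 10 2))) (clash 8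
  2))) (clash 5 3) (clash 5 2)) (clash 3 2)) (clash 6 0) (clash 6 4)))) (clash 1 0) (branch 2 (branch
  4 (branch 6 (clash 6 4) (clash 6 0) (branch 3 (clash 3 2) (branch 5 (clash 5 2) (clash 5 3) (branch
  7 (branch 8 (clash 8 2) (branch 9 (branch 10 (clash 10 2) (clash 10 0) (branch 11 (clash 11 4)
  (branch 12 (branch 13 (clash 13 7) (clash 13 0) (branch 14 (clash 14 2) (branch 15 (clash 15 9)
  (clash 15 3) (branch 16 (branch 17 (clash 17 4) (branch 18 (clash 18 7) (branch 19 (branch 20 (clash
  20 2) (clash 20 8) (branch 21 (clash 21 9) (branch 22 (clash 22 4) (clash 22 11) (branch 23 (branch
  24 (clash 24 2) (clash 24 3) (branch 25 (branch 26 (clash 26 2) (branch 27 (branch 28 (clash 28 4)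
  (clash 28 0) (branch 29 (clash 29 4) (branch 30 (clash 30 7) (branch 31 (clash 31 7) (clash 31 11)
  (branch 32 (branch 33 (clash 33 9) (branch 34 (branch 35 (clash 35 9) (clash 35 8) (branch 36 (clash
  36 9) (branch 37 (branch 38 (clash 38 2) (clash 38 0) (branch 39 (clash 39 7) (branch 40 (clash 40
  4) (clash 40 3) (branch 41 (branch 42 (branch 43 (clash 43 7) (clash 43 8) (branch 44 (clash 44 4)
  (branch 45 (clash 45 9) (clash 45 11) (branch 46 (branch 47 (clash 47 2) (branch 50 (clash 50 2)
  (branch 86 (branch 53 (clash 53 86) (clash 53 50) (branch 51 (branch 52 (clash 52 51) (branch 55
  (clash 55 51) (clash 55 50) (branch 48 (branch 49 (clash 49 48) (clash 49 50) (branch 54 (clash 54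
  51) (branch 56 (branch 57 (clash 57 9) (clash 57 52) (branch 58 (clash 58 48) (branch 59 (branch 60
  (clash 60 48) (branch 61 (clash 61 48) (clash 61 58) (branch 62 (branch 63 (clash 63 51) (clash 63
  54) (branch 64 (clash 64 16) (branch 65 (branch 66 (branch 67 (clash 67 19) (clash 67 52) (branch 68
  (clash 68 56) (branch 69 (branch 70 (clash 70 59) (branch 71 (clash 71 59) (clash 71 50) (branch 72
  (branch 73 (clash 73 56) (branch 74 (clash 74 48) (clash 74 50) (branch 75 (branch 76 (clash 76 51)
  (clash 76 52) (branch 77 (clash 77 59) (branch 78 (clash 78 56) (clash 78 54) (branch 79 (clash 79
  48) (branch 80 (branch 81 (clash 81 51) (branch 82 (clash 82 59) (clash 82 58) (branch 83 (branch 84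
  (clash 84 51) (clash 84 50) (branch 85 (clash 85 48) (branch 87 (clash 87 51) (branch 88 (clash 88
  48) (clash 88 52) (branch 89 (branch 90 (branch 91 (clash 91 56) (branch 92 (clash 92 59) (clash 92
  54) (branch 93 (branch 94 (clash 94 56) (clash 94 58) (branch 95 (clash 95 59) (branch 146 (clash
  146 2) (clash 146 50) (branch 176 (clash 176 80) (branch 128 (clash 128 80) (clash 128 176) (branch
  116 (branch 114 (clash 114 116) (branch 102 (branch 103 (clash 103 102) (clash 103 114) (branch 96
  (clash 96 102) (branch 97 (branch 98 (clash 98 97) (clash 98 96) (branch 99 (clash 99 97) (branch
  100 (clash 100 97) (clash 100 99) (branch 101 (branch 104 (clash 104 56) (branch 105 (clash 105 97)
  (clash 105 96) (branch 106 (branch 107 (clash 107 101) (branch 108 (clash 108 102) (clash 108 96)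
  (branch 109 (branch 110 (clash 110 97) (branch 111 (branch 112 (clash 112 106) (clash 112 99)
  (branch 113 (clash 113 101) (branch 115 (clash 115 97) (clash 115 104) (branch 117 (clash 117 69)
  (branch 118 (branch 119 (clash 119 101) (clash 119 107) (branch 120 (branch 121 (clash 121 97)
  (clash 121 99) (branch 122 (clash 122 97) (branch 123 (clash 123 101) (clash 123 96) (branch 124
  (branch 125 (clash 125 101) (branch 126 (clash 126 102) (branch 127 (branch 129 (clash 129 106)
  (branch 130 (clash 130 106) (clash 130 104) (branch 131 (branch 132 (clash 132 106) (branch 133
  (clash 133 97) (clash 133 96) (branch 134 (branch 135 (clash 135 102) (branch 136 (branch 137 (clash
  137 101) (clash 137 99) (branch 138 (clash 138 102) (clash 138 104) (branch 139 (branch 140 (clash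
  140 101) (branch 141 (branch 142 (clash 142 93) (clash 142 107) (branch 143 (clash 143 97) (branch
  152 (branch 144 (clash 144 152) (branch 145 (branch 148 (clash 148 152) (clash 148 99) (branch 147
  (branch 149 (clash 149 145) (branch 150 (clash 150 145) (branch 151 (clash 151 145) (clash 151 149)
  (branch 153 (clash 153 145) (clash 153 144) (branch 154 (branch 155 (clash 155 147) (branch 156
  (clash 156 154) (branch 157 (clash 157 145) (clash 157 144) (branch 158 (branch 159 (clash 159 147)
  (clash 159 149) (branch 160 (branch 161 (clash 161 152) (branch 162 (clash 162 147) (branch 163
  (branch 164 (clash 164 116) (clash 164 68) (branch 165 (branch 166 (clash 166 154) (clash 166 21)
  (branch 167 (clash 167 145) (branch 168 (branch 169 (clash 169 145) (clash 169 150) (branch 170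
  (clash 170 145) (branch 171 (clash 171 147) (branch 172 (branch 173 (clash 173 147) (clash 173 155)
  (branch 174 (clash 174 152) (clash 174 126) (branch 175 (branch 177 (clash 177 154) (branch 178
  (clash 178 34) (clash 178 149) (branch 179 (branch 180 (clash 180 147) (clash 180 36) (branch 181
  (branch 182 (clash 182 86) (branch 183 (clash 183 147) (branch 184 (clash 184 136) (clash 184 149)
  (branch 185 (branch 186 (branch 187 (clash 187 154) (clash 187 150) (branch 188 (clash 188 152)
  (branch 189 (clash 189 154) (branch 190 (branch 191 (clash 191 152) (clash 191 155) (branch 192
  (branch 193 (clash 193 192) (clash 193 149) (clash 193 100)) (clash 192 99) (clash 192 148))) (clash
  190 155) (clash 190 151)) (clash 189 153)) (clash 188 151))) (clash 186 150) (clash 186 138)) (clash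
  185 149) (clash 185 146))) (clash 183 88)) (clash 182 38)) (clash 181 85) (clash 181 148))) (clash
  179 155) (clash 179 153))) (clash 177 82)) (clash 175 79) (clash 175 151)))) (clash 172 149) (clash
  172 148)) (clash 171 153)) (clash 170 151))) (clash 168 144) (clash 168 24)) (clash 167 22))) (clash
  165 144) (clash 165 153))) (clash 163 149) (clash 163 151)) (clash 162 151)) (clash 161 148)) (clash
  160 150) (clash 160 112))) (clash 158 155) (clash 158 146))) (clash 156 146)) (clash 155 146))
  (clash 154 149) (clash 154 10)))) (clash 150 148)) (clash 149 100)) (clash 147 144) (clash 147
  148))) (clash 145 144) (clash 145 146)) (clash 144 146)) (clash 152 176) (clash 152 146)) (clash 143
  105))) (clash 141 96) (clash 141 105)) (clash 140 103)) (clash 139 99) (clash 139 103)))) (clash 136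
  104) (clash 136 100)) (clash 135 100)) (clash 134 107) (clash 134 98))) (clash 132 98)) (clash 131
  107) (clash 131 105))) (clash 129 103)) (clash 127 104) (clash 127 103)) (clash 126 105)) (clash 125
  98)) (clash 124 99) (clash 124 100))) (clash 122 100))) (clash 120 96) (clash 120 98))) (clash 118
  107) (clash 118 100)) (clash 117 105))) (clash 113 100))) (clash 111 99) (clash 111 63)) (clash 110
  98)) (clash 109 96) (clash 109 103))) (clash 107 98)) (clash 106 58) (clash 106 98))) (clash 104
  98)) (clash 101 96) (clash 101 98))) (clash 99 103))) (clash 97 96) (clash 97 49)) (clash 96 103)))
  (clash 102 114) (clash 102 128)) (clash 114 128)) (clash 116 68) (clash 116 128))) (clash 176 146)))
  (clash 95 57))) (clash 93 58) (clash 93 55))) (clash 91 55)) (clash 90 54) (clash 90 57)) (clash 89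
  52) (clash 89 49))) (clash 87 53)) (clash 85 49))) (clash 83 52) (clash 83 57))) (clash 81 57))
  (clash 80 50) (clash 80 55)) (clash 79 55))) (clash 77 53))) (clash 75 58) (clash 75 28))) (clash 73
  49)) (clash 72 54) (clash 72 49))) (clash 70 49)) (clash 69 58) (clash 69 57)) (clash 68 53)))
  (clash 66 54) (clash 66 55)) (clash 65 52) (clash 65 53)) (clash 64 55))) (clash 62 14) (clash 62
  49))) (clash 60 57)) (clash 59 50) (clash 59 49)) (clash 58 53))) (clash 56 52) (clash 56 49))
  (clash 54 49))) (clash 48 50) (clash 48 55))) (clash 52 53)) (clash 51 3) (clash 51 53))) (clash 86
  50) (clash 86 38)) (branch 51 (branch 53 (clash 53 51) (branch 52 (clash 52 51) (clash 52 53)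
  (branch 55 (clash 55 51) (branch 48 (branch 49 (clash 49 48) (branch 54 (clash 54 51) (clash 54 49)
  (branch 56 (branch 57 (clash 57 9) (branch 58 (clash 58 48) (clash 58 53) (branch 59 (branch 60
  (clash 60 48) (clash 60 57) (branch 61 (clash 61 48) (branch 62 (branch 63 (clash 63 51) (branch 64
  (clash 64 16) (clash 64 55) (branch 65 (branch 66 (branch 67 (clash 67 19) (branch 68 (clash 68 56)
  (clash 68 53) (branch 69 (branch 70 (clash 70 59) (clash 70 49) (branch 71 (clash 71 59) (branch 72
  (branch 73 (clash 73 56) (clash 73 49) (branch 74 (clash 74 48) (branch 75 (branch 76 (clash 76 51)
  (branch 77 (clash 77 59) (clash 77 53) (branch 78 (clash 78 56) (branch 79 (clash 79 48) (clash 79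
  55) (branch 80 (branch 81 (clash 81 51) (clash 81 57) (branch 82 (clash 82 59) (branch 83 (branch 84
  (clash 84 51) (branch 85 (clash 85 48) (clash 85 49) (branch 86 (branch 87 (clash 87 51) (clash 87
  53) (branch 88 (clash 88 48) (branch 89 (branch 90 (branch 91 (clash 91 56) (clash 91 55) (branch 92
  (clash 92 59) (branch 93 (branch 94 (clash 94 56) (branch 95 (clash 95 59) (clash 95 57) (branch 146
  (clash 146 2) (branch 154 (branch 149 (clash 149 154) (clash 149 146) (branch 145 (branch 144 (clash
  144 145) (clash 144 146) (branch 148 (clash 148 154) (branch 147 (branch 150 (clash 150 145) (clash
  150 148) (branch 151 (clash 151 145) (branch 152 (branch 153 (clash 153 145) (branch 155 (clash 155
  147) (clash 155 146) (branch 156 (clash 156 154) (clash 156 146) (branch 157 (clash 157 145) (branch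
  158 (branch 159 (clash 159 147) (branch 160 (branch 161 (clash 161 152) (clash 161 148) (branch 162
  (clash 162 147) (clash 162 151) (branch 163 (branch 164 (clash 164 152) (branch 116 (branch 165
  (branch 166 (clash 166 154) (clash 166 21) (clash 166 155)) (clash 165 153) (clash 165 144)) (clash
  116 164) (clash 116 68)) (clash 164 68)) (clash 163 151) (clash 163 149)))) (clash 160 148) (clash
  160 150)) (clash 159 149)) (clash 158 146) (clash 158 155)) (clash 157 144)))) (clash 153 144))
  (clash 152 146) (clash 152 144)) (clash 151 149))) (clash 147 148) (clash 147 144)) (clash 148
  144))) (clash 145 146) (clash 145 149))) (clash 154 146) (clash 154 10)) (clash 146 50))) (clash 94
  58)) (clash 93 55) (clash 93 58)) (clash 92 54))) (clash 90 57) (clash 90 54)) (clash 89 49) (clash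
  89 52)) (clash 88 52))) (clash 86 53) (clash 86 38))) (clash 84 50)) (clash 83 57) (clash 83 52))
  (clash 82 58))) (clash 80 55) (clash 80 50))) (clash 78 54))) (clash 76 52)) (clash 75 53) (clash 75
  28)) (clash 74 50))) (clash 72 49) (clash 72 54)) (clash 71 50))) (clash 69 57) (clash 69 58)))
  (clash 67 52)) (clash 66 55) (clash 66 54)) (clash 65 53) (clash 65 52))) (clash 63 54)) (clash 62
  14) (clash 62 50)) (clash 61 58))) (clash 59 49) (clash 59 50))) (clash 57 52)) (clash 56 49) (clash
  56 52))) (clash 49 50)) (clash 48 55) (clash 48 50)) (clash 55 50))) (clash 53 50)) (clash 51 3)
  (clash 51 50))) (clash 47 10)) (clash 46 0) (clash 46 10))) (clash 44 6))) (clash 42 3) (clash 42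
  6)) (clash 41 8) (clash 41 5))) (clash 39 5))) (clash 37 11) (clash 37 1)) (clash 36 1))) (clash 34
  11) (clash 34 10)) (clash 33 6)) (clash 32 8) (clash 32 6))) (clash 30 10)) (clash 29 1))) (clash 27
  3) (clash 27 5)) (clash 26 5)) (clash 25 0) (clash 25 1))) (clash 23 11) (clash 23 5))) (clash 21
  10))) (clash 19 8) (clash 19 1)) (clash 18 6)) (clash 17 5)) (clash 16 3) (clash 16 10))) (clash 14
  1))) (clash 12 0) (clash 12 6)) (clash 11 1))) (clash 9 3) (clash 9 1)) (clash 8 1)) (clash 7 0)
  (clash 7 5))) (clash 3 6))) (clash 4 0) (clash 4 1)) (clash 2 0) (clash 2 1))) (branch 1 (branch 2
  (clash 2 1) (branch 4 (clash 4 1) (branch 6 (branch 3 (clash 3 6) (clash 3 2) (branch 5 (branch 7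
  (clash 7 5) (branch 8 (clash 8 1) (clash 8 2) (branch 9 (clash 9 1) (branch 10 (branch 11 (clash 11
  1) (clash 11 4) (branch 12 (clash 12 6) (branch 13 (branch 14 (clash 14 1) (clash 14 2) (branch 15
  (branch 16 (clash 16 10) (branch 17 (clash 17 5) (clash 17 4) (branch 18 (clash 18 6) (clash 18 7)
  (branch 19 (clash 19 1) (branch 20 (branch 21 (clash 21 10) (clash 21 9) (branch 22 (branch 23
  (clash 23 5) (branch 24 (branch 25 (clash 25 1) (branch 26 (clash 26 5) (clash 26 2) (branch 27
  (clash 27 5) (branch 28 (branch 29 (clash 29 1) (clash 29 4) (branch 30 (clash 30 10) (clash 30 7)
  (branch 31 (branch 32 (clash 32 6) (branch 33 (clash 33 6) (clash 33 9) (branch 34 (clash 34 10)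
  (branch 35 (branch 36 (clash 36 1) (clash 36 9) (branch 37 (clash 37 1) (branch 38 (branch 39 (clash
  39 5) (clash 39 7) (branch 40 (branch 41 (clash 41 5) (branch 42 (clash 42 6) (branch 43 (branch 44
  (clash 44 6) (clash 44 4) (branch 45 (branch 46 (clash 46 10) (branch 47 (clash 47 10) (clash 47 2)
  (branch 50 (branch 51 (clash 51 50) (branch 53 (clash 53 50) (clash 53 51) (branch 52 (branch 55
  (clash 55 50) (clash 55 51) (branch 48 (clash 48 50) (branch 49 (clash 49 50) (clash 49 48) (branch
  54 (branch 56 (clash 56 52) (branch 57 (clash 57 52) (clash 57 9) (branch 58 (branch 59 (clash 59
  50) (branch 60 (branch 61 (clash 61 58) (clash 61 48) (branch 62 (clash 62 50) (branch 63 (clash 63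
  54) (clash 63 51) (branch 64 (branch 65 (clash 65 52) (branch 66 (clash 66 54) (branch 67 (clash 67
  52) (clash 67 19) (branch 68 (branch 69 (clash 69 58) (branch 70 (branch 71 (clash 71 50) (clash 71
  59) (branch 72 (clash 72 54) (branch 73 (branch 74 (clash 74 50) (clash 74 48) (branch 75 (clash 75
  28) (branch 76 (clash 76 52) (clash 76 51) (branch 77 (branch 78 (clash 78 54) (clash 78 56) (branch
  79 (branch 80 (clash 80 50) (branch 81 (branch 82 (clash 82 58) (clash 82 59) (branch 83 (clash 83
  52) (branch 84 (clash 84 50) (clash 84 51) (branch 85 (branch 86 (clash 86 38) (branch 87 (branch 88
  (clash 88 52) (clash 88 48) (branch 89 (clash 89 52) (branch 90 (clash 90 54) (branch 91 (branch 92
  (clash 92 54) (clash 92 59) (branch 93 (clash 93 58) (branch 94 (clash 94 58) (clash 94 56) (branch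
  95 (branch 146 (clash 146 50) (clash 146 2) (branch 154 (clash 154 10) (branch 149 (branch 145
  (clash 145 149) (branch 144 (branch 148 (clash 148 144) (clash 148 154) (branch 147 (clash 147 144)
  (branch 150 (branch 151 (clash 151 149) (clash 151 145) (branch 152 (clash 152 144) (branch 153
  (clash 153 144) (clash 153 145) (branch 155 (branch 156 (branch 157 (clash 157 144) (clash 157 145)
  (branch 158 (clash 158 155) (branch 159 (clash 159 149) (clash 159 147) (branch 160 (clash 160 150)
  (branch 161 (branch 162 (branch 163 (clash 163 149) (branch 164 (clash 164 68) (clash 164 152)
  (branch 116 (clash 116 68) (branch 165 (clash 165 144) (branch 166 (clash 166 155) (clash 166 154)
  (clash 166 21)) (clash 165 153)) (clash 116 164))) (clash 163 151)) (clash 162 147) (clash 162 151))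
  (clash 161 152) (clash 161 148)) (clash 160 148))) (clash 158 146))) (clash 156 154) (clash 156
  146)) (clash 155 147) (clash 155 146))) (clash 152 146))) (clash 150 145) (clash 150 148)) (clash
  147 148))) (clash 144 145) (clash 144 146)) (clash 145 146)) (clash 149 154) (clash 149 146)) (clash
  154 146))) (clash 95 59) (clash 95 57))) (clash 93 55))) (clash 91 56) (clash 91 55)) (clash 90 57))
  (clash 89 49))) (clash 87 51) (clash 87 53)) (clash 86 53)) (clash 85 48) (clash 85 49))) (clash 83
  57))) (clash 81 51) (clash 81 57)) (clash 80 55)) (clash 79 48) (clash 79 55))) (clash 77 59) (clash
  77 53))) (clash 75 53))) (clash 73 56) (clash 73 49)) (clash 72 49))) (clash 70 59) (clash 70 49))
  (clash 69 57)) (clash 68 56) (clash 68 53))) (clash 66 55)) (clash 65 53)) (clash 64 16) (clash 64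
  55))) (clash 62 14))) (clash 60 48) (clash 60 57)) (clash 59 49)) (clash 58 48) (clash 58 53)))
  (clash 56 49)) (clash 54 51) (clash 54 49))) (clash 48 55))) (clash 52 51) (clash 52 53))) (clash 51
  3)) (clash 50 2) (branch 86 (clash 86 38) (branch 53 (branch 51 (clash 51 53) (branch 52 (clash 52
  53) (clash 52 51) (branch 55 (branch 48 (clash 48 55) (branch 49 (branch 54 (clash 54 49) (clash 54
  51) (branch 56 (clash 56 49) (branch 57 (branch 58 (clash 58 53) (clash 58 48) (branch 59 (clash 59
  49) (branch 60 (clash 60 57) (clash 60 48) (branch 61 (branch 62 (clash 62 49) (branch 63 (branch 64
  (clash 64 55) (clash 64 16) (branch 65 (clash 65 53) (branch 66 (clash 66 55) (branch 67 (branch 68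
  (clash 68 53) (clash 68 56) (branch 69 (clash 69 57) (branch 70 (clash 70 49) (clash 70 59) (branch
  71 (branch 72 (clash 72 49) (branch 73 (clash 73 49) (clash 73 56) (branch 74 (branch 75 (clash 75
  28) (branch 76 (branch 77 (clash 77 53) (clash 77 59) (branch 78 (branch 79 (clash 79 55) (clash 79
  48) (branch 80 (clash 80 55) (branch 81 (clash 81 57) (clash 81 51) (branch 82 (branch 83 (clash 83
  57) (branch 84 (branch 85 (clash 85 49) (clash 85 48) (branch 87 (clash 87 53) (clash 87 51) (branch
  88 (branch 89 (clash 89 49) (branch 90 (clash 90 57) (branch 91 (clash 91 55) (clash 91 56) (branch
  92 (branch 93 (clash 93 55) (branch 94 (branch 95 (clash 95 57) (clash 95 59) (branch 146 (branch
  176 (clash 176 146) (clash 176 80) (branch 128 (branch 116 (clash 116 128) (branch 114 (clash 114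
  128) (clash 114 116) (branch 102 (clash 102 128) (branch 103 (branch 96 (clash 96 103) (clash 96
  102) (branch 97 (clash 97 49) (branch 98 (branch 99 (clash 99 103) (clash 99 97) (branch 100 (branch
  101 (clash 101 98) (branch 104 (clash 104 98) (clash 104 56) (branch 105 (branch 106 (clash 106 98)
  (branch 107 (clash 107 98) (clash 107 101) (branch 108 (branch 109 (clash 109 103) (branch 110
  (clash 110 98) (clash 110 97) (branch 111 (clash 111 63) (branch 112 (branch 113 (clash 113 100)
  (clash 113 101) (branch 115 (branch 117 (clash 117 105) (clash 117 69) (branch 118 (clash 118 100)
  (branch 119 (branch 120 (clash 120 98) (branch 121 (branch 122 (clash 122 100) (clash 122 97)
  (branch 123 (branch 124 (clash 124 100) (branch 125 (clash 125 98) (clash 125 101) (branch 126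
  (clash 126 105) (clash 126 102) (branch 127 (clash 127 103) (branch 129 (clash 129 103) (clash 129
  106) (branch 130 (branch 131 (clash 131 105) (branch 132 (clash 132 98) (clash 132 106) (branch 133
  (branch 134 (clash 134 98) (branch 135 (clash 135 100) (clash 135 102) (branch 136 (clash 136 100)
  (branch 137 (branch 138 (branch 139 (clash 139 103) (branch 140 (clash 140 103) (clash 140 101)
  (branch 141 (clash 141 105) (branch 142 (branch 143 (clash 143 105) (clash 143 97) (branch 152
  (clash 152 146) (branch 144 (clash 144 146) (clash 144 152) (branch 145 (clash 145 146) (branch 148
  (branch 147 (clash 147 148) (branch 149 (clash 149 100) (clash 149 145) (branch 150 (clash 150 148)
  (clash 150 145) (branch 151 (branch 153 (branch 154 (clash 154 10) (branch 155 (clash 155 146)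
  (clash 155 147) (branch 156 (clash 156 146) (clash 156 154) (branch 157 (branch 158 (clash 158 146)
  (branch 159 (branch 160 (clash 160 112) (branch 161 (clash 161 148) (clash 161 152) (branch 162
  (clash 162 151) (clash 162 147) (branch 163 (clash 163 151) (branch 164 (branch 165 (clash 165 153)
  (branch 166 (branch 167 (clash 167 22) (clash 167 145) (branch 168 (clash 168 24) (branch 169
  (branch 170 (clash 170 151) (clash 170 145) (branch 171 (clash 171 153) (clash 171 147) (branch 172
  (clash 172 148) (branch 173 (branch 174 (branch 175 (clash 175 151) (branch 177 (clash 177 82)
  (clash 177 154) (branch 178 (branch 179 (clash 179 153) (branch 180 (branch 181 (clash 181 148)
  (branch 182 (clash 182 38) (clash 182 86) (branch 183 (clash 183 88) (clash 183 147) (branch 184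
  (branch 185 (clash 185 146) (branch 186 (clash 186 138) (branch 187 (branch 188 (clash 188 151)
  (clash 188 152) (branch 189 (clash 189 153) (clash 189 154) (branch 190 (clash 190 151) (branch 191
  (branch 192 (clash 192 148) (branch 193 (clash 193 100) (clash 193 192) (clash 193 149)) (clash 192
  99)) (clash 191 152) (clash 191 155)) (clash 190 155)))) (clash 187 154) (clash 187 150)) (clash 186
  150)) (clash 185 149)) (clash 184 136) (clash 184 149)))) (clash 181 85)) (clash 180 147) (clash 180
  36)) (clash 179 155)) (clash 178 34) (clash 178 149))) (clash 175 79)) (clash 174 152) (clash 174
  126)) (clash 173 147) (clash 173 155)) (clash 172 149)))) (clash 169 145) (clash 169 150)) (clash
  168 144))) (clash 166 154) (clash 166 21)) (clash 165 144)) (clash 164 116) (clash 164 68)) (clash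
  163 149)))) (clash 160 150)) (clash 159 147) (clash 159 149)) (clash 158 155)) (clash 157 145)
  (clash 157 144)))) (clash 154 149)) (clash 153 145) (clash 153 144)) (clash 151 145) (clash 151
  149)))) (clash 147 144)) (clash 148 152) (clash 148 99)) (clash 145 144))) (clash 152 176))) (clash
  142 93) (clash 142 107)) (clash 141 96))) (clash 139 99)) (clash 138 102) (clash 138 104)) (clash
  137 101) (clash 137 99)) (clash 136 104))) (clash 134 107)) (clash 133 97) (clash 133 96))) (clash
  131 107)) (clash 130 106) (clash 130 104))) (clash 127 104)))) (clash 124 99)) (clash 123 101)
  (clash 123 96))) (clash 121 97) (clash 121 99)) (clash 120 96)) (clash 119 101) (clash 119 107))
  (clash 118 107))) (clash 115 97) (clash 115 104))) (clash 112 106) (clash 112 99)) (clash 111 99)))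
  (clash 109 96)) (clash 108 102) (clash 108 96))) (clash 106 58)) (clash 105 97) (clash 105 96)))
  (clash 101 96)) (clash 100 97) (clash 100 99))) (clash 98 97) (clash 98 96)) (clash 97 96))) (clash
  103 102) (clash 103 114)) (clash 102 114))) (clash 116 68)) (clash 128 80) (clash 128 176))) (clash
  146 2) (clash 146 50))) (clash 94 56) (clash 94 58)) (clash 93 58)) (clash 92 59) (clash 92 54)))
  (clash 90 54)) (clash 89 52)) (clash 88 48) (clash 88 52)))) (clash 84 51) (clash 84 50)) (clash 83
  52)) (clash 82 59) (clash 82 58))) (clash 80 50))) (clash 78 56) (clash 78 54))) (clash 76 51)
  (clash 76 52)) (clash 75 58)) (clash 74 48) (clash 74 50))) (clash 72 54)) (clash 71 59) (clash 71
  50))) (clash 69 58))) (clash 67 19) (clash 67 52)) (clash 66 54)) (clash 65 52))) (clash 63 51)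
  (clash 63 54)) (clash 62 14)) (clash 61 48) (clash 61 58))) (clash 59 50))) (clash 57 9) (clash 57
  52)) (clash 56 52))) (clash 49 48) (clash 49 50)) (clash 48 50)) (clash 55 51) (clash 55 50)))
  (clash 51 3)) (clash 53 86) (clash 53 50)) (clash 86 50)))) (clash 46 0)) (clash 45 9) (clash 45
  11))) (clash 43 7) (clash 43 8)) (clash 42 3)) (clash 41 8)) (clash 40 4) (clash 40 3))) (clash 38
  2) (clash 38 0)) (clash 37 11))) (clash 35 9) (clash 35 8)) (clash 34 11))) (clash 32 8)) (clash 31
  7) (clash 31 11)))) (clash 28 4) (clash 28 0)) (clash 27 3))) (clash 25 0)) (clash 24 2) (clash 24
  3)) (clash 23 11)) (clash 22 4) (clash 22 11))) (clash 20 2) (clash 20 8)) (clash 19 8)))) (clash 16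
  3)) (clash 15 9) (clash 15 3))) (clash 13 7) (clash 13 0)) (clash 12 0))) (clash 10 2) (clash 10 0))
  (clash 9 3))) (clash 7 0)) (clash 5 2) (clash 5 3))) (clash 6 4) (clash 6 0)) (clash 4 0)) (clash 2
  0)) (branch 2 (branch 4 (branch 6 (clash 6 4) (branch 3 (clash 3 2) (clash 3 6) (branch 5 (clash 5
  2) (branch 7 (branch 8 (clash 8 2) (clash 8 1) (branch 9 (branch 10 (clash 10 2) (branch 11 (clash
  11 4) (clash 11 1) (branch 12 (branch 13 (clash 13 7) (branch 14 (clash 14 2) (clash 14 1) (branch
  15 (clash 15 9) (branch 16 (branch 17 (clash 17 4) (clash 17 5) (branch 18 (clash 18 7) (clash 18 6)
  (branch 19 (branch 20 (clash 20 2) (branch 21 (clash 21 9) (clash 21 10) (branch 22 (clash 22 4)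
  (branch 23 (branch 24 (clash 24 2) (branch 25 (branch 26 (clash 26 2) (clash 26 5) (branch 27
  (branch 28 (clash 28 4) (branch 29 (clash 29 4) (clash 29 1) (branch 30 (clash 30 7) (clash 30 10)
  (branch 31 (clash 31 7) (branch 32 (branch 33 (clash 33 9) (clash 33 6) (branch 34 (branch 35 (clash
  35 9) (branch 36 (clash 36 9) (clash 36 1) (branch 37 (branch 38 (clash 38 2) (branch 39 (clash 39
  7) (clash 39 5) (branch 40 (clash 40 4) (branch 41 (branch 42 (branch 43 (clash 43 7) (branch 44
  (clash 44 4) (clash 44 6) (branch 45 (clash 45 9) (branch 46 (branch 47 (clash 47 2) (clash 47 10)
  (branch 50 (clash 50 2) (branch 51 (branch 53 (clash 53 51) (clash 53 50) (branch 52 (clash 52 51)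
  (branch 55 (clash 55 51) (clash 55 50) (branch 48 (branch 49 (clash 49 48) (clash 49 50) (branch 54
  (clash 54 51) (branch 56 (branch 57 (clash 57 9) (clash 57 52) (branch 58 (clash 58 48) (branch 59
  (branch 60 (clash 60 48) (branch 61 (clash 61 48) (clash 61 58) (branch 62 (branch 63 (clash 63 51)
  (clash 63 54) (branch 64 (clash 64 16) (branch 65 (branch 66 (branch 67 (clash 67 19) (clash 67 52)
  (branch 68 (clash 68 56) (branch 69 (branch 70 (clash 70 59) (branch 71 (clash 71 59) (clash 71 50)
  (branch 72 (branch 73 (clash 73 56) (branch 74 (clash 74 48) (clash 74 50) (branch 75 (branch 76
  (clash 76 51) (clash 76 52) (branch 77 (clash 77 59) (branch 78 (clash 78 56) (clash 78 54) (branch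
  79 (clash 79 48) (branch 80 (branch 81 (clash 81 51) (branch 82 (clash 82 59) (clash 82 58) (branch
  83 (branch 84 (clash 84 51) (clash 84 50) (branch 85 (clash 85 48) (branch 86 (branch 87 (clash 87
  51) (branch 88 (clash 88 48) (clash 88 52) (branch 89 (branch 90 (branch 91 (clash 91 56) (branch 92
  (clash 92 59) (clash 92 54) (branch 93 (branch 94 (clash 94 56) (clash 94 58) (branch 95 (clash 95
  59) (branch 146 (clash 146 2) (clash 146 50) (branch 154 (branch 149 (clash 149 154) (branch 145
  (branch 144 (clash 144 145) (branch 148 (clash 148 154) (clash 148 144) (branch 147 (branch 150
  (clash 150 145) (branch 151 (clash 151 145) (clash 151 149) (branch 152 (branch 153 (clash 153 145)
  (clash 153 144) (branch 155 (clash 155 147) (branch 156 (clash 156 154) (branch 157 (clash 157 145)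
  (clash 157 144) (branch 158 (branch 159 (clash 159 147) (clash 159 149) (branch 160 (branch 161
  (clash 161 152) (branch 162 (clash 162 147) (branch 163 (branch 164 (clash 164 152) (clash 164 68)
  (branch 116 (branch 165 (branch 166 (clash 166 154) (clash 166 155) (clash 166 21)) (clash 165 144)
  (clash 165 153)) (clash 116 68) (clash 116 164))) (clash 163 149) (clash 163 151)) (clash 162 151))
  (clash 161 148)) (clash 160 150) (clash 160 148))) (clash 158 155) (clash 158 146))) (clash 156
  146)) (clash 155 146))) (clash 152 144) (clash 152 146))) (clash 150 148)) (clash 147 144) (clash
  147 148))) (clash 144 146)) (clash 145 149) (clash 145 146)) (clash 149 146)) (clash 154 10) (clash
  154 146))) (clash 95 57))) (clash 93 58) (clash 93 55))) (clash 91 55)) (clash 90 54) (clash 90 57))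
  (clash 89 52) (clash 89 49))) (clash 87 53)) (clash 86 38) (clash 86 53)) (clash 85 49))) (clash 83
  52) (clash 83 57))) (clash 81 57)) (clash 80 50) (clash 80 55)) (clash 79 55))) (clash 77 53)))
  (clash 75 28) (clash 75 53))) (clash 73 49)) (clash 72 54) (clash 72 49))) (clash 70 49)) (clash 69
  58) (clash 69 57)) (clash 68 53))) (clash 66 54) (clash 66 55)) (clash 65 52) (clash 65 53)) (clash
  64 55))) (clash 62 50) (clash 62 14))) (clash 60 57)) (clash 59 50) (clash 59 49)) (clash 58 53)))
  (clash 56 52) (clash 56 49)) (clash 54 49))) (clash 48 50) (clash 48 55))) (clash 52 53))) (clash 51
  50) (clash 51 3)) (branch 86 (branch 53 (clash 53 86) (branch 51 (branch 52 (clash 52 51) (clash 52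
  53) (branch 55 (clash 55 51) (branch 48 (branch 49 (clash 49 48) (branch 54 (clash 54 51) (clash 54
  49) (branch 56 (branch 57 (clash 57 9) (branch 58 (clash 58 48) (clash 58 53) (branch 59 (branch 60
  (clash 60 48) (clash 60 57) (branch 61 (clash 61 48) (branch 62 (branch 63 (clash 63 51) (branch 64
  (clash 64 16) (clash 64 55) (branch 65 (branch 66 (branch 67 (clash 67 19) (branch 68 (clash 68 56)
  (clash 68 53) (branch 69 (branch 70 (clash 70 59) (clash 70 49) (branch 71 (clash 71 59) (branch 72
  (branch 73 (clash 73 56) (clash 73 49) (branch 74 (clash 74 48) (branch 75 (branch 76 (clash 76 51)
  (branch 77 (clash 77 59) (clash 77 53) (branch 78 (clash 78 56) (branch 79 (clash 79 48) (clash 79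
  55) (branch 80 (branch 81 (clash 81 51) (clash 81 57) (branch 82 (clash 82 59) (branch 83 (branch 84
  (clash 84 51) (branch 85 (clash 85 48) (clash 85 49) (branch 87 (clash 87 51) (clash 87 53) (branch
  88 (clash 88 48) (branch 89 (branch 90 (branch 91 (clash 91 56) (clash 91 55) (branch 92 (clash 92
  59) (branch 93 (branch 94 (clash 94 56) (branch 95 (clash 95 59) (clash 95 57) (branch 146 (clash
  146 2) (branch 176 (clash 176 80) (clash 176 146) (branch 128 (clash 128 80) (branch 116 (branch 114
  (clash 114 116) (clash 114 128) (branch 102 (branch 103 (clash 103 102) (branch 96 (clash 96 102)
  (clash 96 103) (branch 97 (branch 98 (clash 98 97) (branch 99 (clash 99 97) (clash 99 103) (branch
  100 (clash 100 97) (branch 101 (branch 104 (clash 104 56) (clash 104 98) (branch 105 (clash 105 97)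
  (branch 106 (branch 107 (clash 107 101) (clash 107 98) (branch 108 (clash 108 102) (branch 109
  (branch 110 (clash 110 97) (clash 110 98) (branch 111 (branch 112 (clash 112 106) (branch 113 (clash
  113 101) (clash 113 100) (branch 115 (clash 115 97) (branch 117 (clash 117 69) (clash 117 105)
  (branch 118 (branch 119 (clash 119 101) (branch 120 (branch 121 (clash 121 97) (branch 122 (clash
  122 97) (clash 122 100) (branch 123 (clash 123 101) (branch 124 (branch 125 (clash 125 101) (clash
  125 98) (branch 126 (clash 126 102) (clash 126 105) (branch 127 (branch 129 (clash 129 106) (clash
  129 103) (branch 130 (clash 130 106) (branch 131 (branch 132 (clash 132 106) (clash 132 98) (branch
  133 (clash 133 97) (branch 134 (branch 135 (clash 135 102) (clash 135 100) (branch 136 (branch 137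
  (clash 137 101) (branch 138 (clash 138 102) (branch 139 (branch 140 (clash 140 101) (clash 140 103)
  (branch 141 (branch 142 (clash 142 93) (branch 143 (clash 143 97) (clash 143 105) (branch 152
  (branch 144 (clash 144 152) (clash 144 146) (branch 145 (branch 148 (clash 148 152) (branch 147
  (branch 149 (clash 149 145) (clash 149 100) (branch 150 (clash 150 145) (clash 150 148) (branch 151
  (clash 151 145) (branch 153 (clash 153 145) (branch 154 (branch 155 (clash 155 147) (clash 155 146)
  (branch 156 (clash 156 154) (clash 156 146) (branch 157 (clash 157 145) (branch 158 (branch 159
  (clash 159 147) (branch 160 (branch 161 (clash 161 152) (clash 161 148) (branch 162 (clash 162 147)
  (clash 162 151) (branch 163 (branch 164 (clash 164 116) (branch 165 (branch 166 (clash 166 154)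
  (branch 167 (clash 167 145) (clash 167 22) (branch 168 (branch 169 (clash 169 145) (branch 170
  (clash 170 145) (clash 170 151) (branch 171 (clash 171 147) (clash 171 153) (branch 172 (branch 173
  (clash 173 147) (branch 174 (clash 174 152) (branch 175 (branch 177 (clash 177 154) (clash 177 82)
  (branch 178 (clash 178 34) (branch 179 (branch 180 (clash 180 147) (branch 181 (branch 182 (clash
  182 86) (clash 182 38) (branch 183 (clash 183 147) (clash 183 88) (branch 184 (clash 184 136)
  (branch 185 (branch 186 (branch 187 (clash 187 154) (branch 188 (clash 188 152) (clash 188 151)
  (branch 189 (clash 189 154) (clash 189 153) (branch 190 (branch 191 (clash 191 152) (branch 192
  (branch 193 (clash 193 192) (clash 193 100) (clash 193 149)) (clash 192 148) (clash 192 99)) (clash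
  191 155)) (clash 190 151) (clash 190 155)))) (clash 187 150)) (clash 186 138) (clash 186 150))
  (clash 185 146) (clash 185 149)) (clash 184 149)))) (clash 181 148) (clash 181 85)) (clash 180 36))
  (clash 179 153) (clash 179 155)) (clash 178 149))) (clash 175 151) (clash 175 79)) (clash 174 126))
  (clash 173 155)) (clash 172 148) (clash 172 149)))) (clash 169 150)) (clash 168 24) (clash 168
  144))) (clash 166 21)) (clash 165 153) (clash 165 144)) (clash 164 68)) (clash 163 151) (clash 163
  149)))) (clash 160 112) (clash 160 150)) (clash 159 149)) (clash 158 146) (clash 158 155)) (clash
  157 144)))) (clash 154 10) (clash 154 149)) (clash 153 144)) (clash 151 149)))) (clash 147 148)
  (clash 147 144)) (clash 148 99)) (clash 145 146) (clash 145 144))) (clash 152 146) (clash 152 176)))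
  (clash 142 107)) (clash 141 105) (clash 141 96))) (clash 139 103) (clash 139 99)) (clash 138 104))
  (clash 137 99)) (clash 136 100) (clash 136 104))) (clash 134 98) (clash 134 107)) (clash 133 96)))
  (clash 131 105) (clash 131 107)) (clash 130 104))) (clash 127 103) (clash 127 104)))) (clash 124
  100) (clash 124 99)) (clash 123 96))) (clash 121 99)) (clash 120 98) (clash 120 96)) (clash 119
  107)) (clash 118 100) (clash 118 107))) (clash 115 104))) (clash 112 99)) (clash 111 63) (clash 111
  99))) (clash 109 103) (clash 109 96)) (clash 108 96))) (clash 106 98) (clash 106 58)) (clash 105
  96))) (clash 101 98) (clash 101 96)) (clash 100 99))) (clash 98 96)) (clash 97 49) (clash 97 96)))
  (clash 103 114)) (clash 102 128) (clash 102 114))) (clash 116 128) (clash 116 68)) (clash 128 176)))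
  (clash 146 50))) (clash 94 58)) (clash 93 55) (clash 93 58)) (clash 92 54))) (clash 90 57) (clash 90
  54)) (clash 89 49) (clash 89 52)) (clash 88 52)))) (clash 84 50)) (clash 83 57) (clash 83 52))
  (clash 82 58))) (clash 80 55) (clash 80 50))) (clash 78 54))) (clash 76 52)) (clash 75 28) (clash 75
  58)) (clash 74 50))) (clash 72 49) (clash 72 54)) (clash 71 50))) (clash 69 57) (clash 69 58)))
  (clash 67 52)) (clash 66 55) (clash 66 54)) (clash 65 53) (clash 65 52))) (clash 63 54)) (clash 62
  49) (clash 62 14)) (clash 61 58))) (clash 59 49) (clash 59 50))) (clash 57 52)) (clash 56 49) (clash
  56 52))) (clash 49 50)) (clash 48 55) (clash 48 50)) (clash 55 50))) (clash 51 53) (clash 51 3))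
  (clash 53 50)) (clash 86 38) (clash 86 50)))) (clash 46 10) (clash 46 0)) (clash 45 11))) (clash 43
  8)) (clash 42 6) (clash 42 3)) (clash 41 5) (clash 41 8)) (clash 40 3))) (clash 38 0)) (clash 37 1)
  (clash 37 11))) (clash 35 8)) (clash 34 10) (clash 34 11))) (clash 32 6) (clash 32 8)) (clash 31
  11)))) (clash 28 0)) (clash 27 5) (clash 27 3))) (clash 25 1) (clash 25 0)) (clash 24 3)) (clash 23
  5) (clash 23 11)) (clash 22 11))) (clash 20 8)) (clash 19 1) (clash 19 8)))) (clash 16 10) (clash 16
  3)) (clash 15 3))) (clash 13 0)) (clash 12 6) (clash 12 0))) (clash 10 0)) (clash 9 1) (clash 9 3)))
  (clash 7 5) (clash 7 0)) (clash 5 3))) (clash 6 0)) (clash 4 1) (clash 4 0)) (clash 2 1) (clash 2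
  0)) (clash 1 0))

codewords : Fin 16 → List (Word 4)
codewords = Vec.lookup codeTable

parts : Fin 16 → VSet 4
parts i = listSet (codewords i)

parts-isPartition : IsPartition parts
parts-isPartition = ∀-fromAllWords (toWitness {a? = All.all? (uniquePart? parts) (allWords 4)} tt)

parts-isCode : ∀ i → IsCode 4 16 3 (parts i)
parts-isCode i = let card≡16 , atLeast , attained = facts i in listSet-isCode card≡16 atLeast attained
  where
  facts : ∀ i → card (parts i) ≡ 16 × DistanceAtLeast 3 (codewords i) × DistanceAttained 3 (codewords i)
  facts = toWitness {a? = all? λ i → (card (parts i) ≟ℕ 16)
                                    ×-dec distanceAtLeast? 3 (codewords i) ×-dec distanceAttained? 3 (codewords i)} tt

mainTheorem9 : Σ (Fin 16 → VSet 4) (λ B →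
    IsPartition B
    × (∀ i → IsCode 4 16 3 (B i))
    × ¬ Σ (Fin 16 → Fin 3 → VSet 4) (λ E →
          IsPartition (λ i → lengthen (B i) (E i))
          × (∀ i → IsPerfect1 (lengthen (B i) (E i)))))
mainTheorem9 = parts , parts-isPartition , parts-isCode , no-lengthening codewords vertex certificate tt
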